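{- Let $\alpha>0$ be a constant. If $g(n)\le \alpha n^2$ for all $n$, then $f_4(n)\le \alpha(1+o(1))\frac{n^2}{2}$ as $n\to\infty$.
   Context: A complete bipartite subgraph of a graph $G$ is given by two nonempty disjoint vertex sets $X,Y$ of $G$ such that every pair $xy$ with $x\in X,y\in Y$ is an edge of $G$; its edge set is all such pairs. For graphs $G,H$, a block is a set of the form $E(B_1)\times E(B_2)$ where $B_1$ is a complete bipartite subgraph of $G$ and $B_2$ a complete bipartite subgraph of $H$. $g(G,H)$ is the minimum number of blocks needed to partition $E(G)\times E(H)$, and $g(n)=g(K_n,K_n)$. A complete $4$-partite $4$-uniform hypergraph has vertex classes $V_1,\dots,V_4$ (nonempty, disjoint) and edges exactly the $4$-sets meeting each class in one vertex; $f_4(n)$ is the minimum number of complete $4$-partite $4$-graphs needed to partition the edge set of the complete $4$-uniform hypergraph $K_n^{(4)}$ on $n$ vertices.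
   Formalization: The constant α and the positive tolerances expressing the o(1) term range over the positive rationals. -}

module Defs where

open import Data.Nat using (ℕ)
open import Data.Fin using (Fin) renaming (_<_ to _<ᶠ_)
open import Data.Fin.Subset using (Subset; _∈_; Nonempty; ⁅_⁆; _∪_; _∩_; ∣_∣)
open import Data.Product using (Σ; _×_; ∃; _,_; proj₁; proj₂)
open import Data.Sum using (_⊎_)
open import Data.Empty using (⊥)
open import Data.Integer using (+_)
open import Data.Rational using (ℚ; _/_; _≤_)
open import Relation.Binary.PropositionalEquality using (_≡_)

ℕ→ℚ : ℕ → ℚ
ℕ→ℚ n = (+ n) / 1

Disjoint : ∀ {n} → Subset n → Subset n → Set
Disjoint {n} X Y = (v : Fin n) → v ∈ X → v ∈ Y → ⊥

-- Graph part: K_n on vertex set Fin n.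
-- An edge of K_n is an unordered pair {u,v}, represented by u <ᶠ v.

Edge : ℕ → Set
Edge n = Σ (Fin n × Fin n) (λ p → proj₁ p <ᶠ proj₂ p)

record CompleteBipartite (n : ℕ) : Set where
  field
    X Y      : Subset n
    X-ne     : Nonempty X
    Y-ne     : Nonempty Y
    disjoint : Disjoint X Y

_∈E_ : ∀ {n} → Edge n → CompleteBipartite n → Set
((u , v) , _) ∈E B = (u ∈ X × v ∈ Y) ⊎ (u ∈ Y × v ∈ X)
  where open CompleteBipartite B

Block : ℕ → Set
Block n = CompleteBipartite n × CompleteBipartite n

_∈Block_ : ∀ {n} → Edge n × Edge n → Block n → Set
(e , f) ∈Block (B₁ , B₂) = (e ∈E B₁) × (f ∈E B₂)

BlockPartition : (n k : ℕ) → Set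
BlockPartition n k =
  Σ (Fin k → Block n) λ 𝓑 →
    (ef : Edge n × Edge n) →
      (∃ λ i → ef ∈Block 𝓑 i) ×
      ((i j : Fin k) → ef ∈Block 𝓑 i → ef ∈Block 𝓑 j → i ≡ j)

-- "g(n) ≤ x"  (g(n) is the least k admitting such a partition)
g≤ : ℕ → ℚ → Set
g≤ n x = Σ ℕ λ k → BlockPartition n k × (ℕ→ℚ k ≤ x)

-- Hypergraph part: K_n^(4) on Fin n.
-- A 4-edge {a,b,c,d} is represented by a <ᶠ b <ᶠ c <ᶠ d.

Edge4 : ℕ → Set
Edge4 n = Σ (Fin n × Fin n × Fin n × Fin n)
            λ { (a , b , c , d) → a <ᶠ b × b <ᶠ c × c <ᶠ d }

toSubset : ∀ {n} → Edge4 n → Subset n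
toSubset (((a , b , c , d)) , _) = ⁅ a ⁆ ∪ ⁅ b ⁆ ∪ ⁅ c ⁆ ∪ ⁅ d ⁆

record Complete4Partite (n : ℕ) : Set where
  field
    V₁ V₂ V₃ V₄ : Subset n
    ne₁ : Nonempty V₁
    ne₂ : Nonempty V₂
    ne₃ : Nonempty V₃
    ne₄ : Nonempty V₄
    d₁₂ : Disjoint V₁ V₂
    d₁₃ : Disjoint V₁ V₃
    d₁₄ : Disjoint V₁ V₄
    d₂₃ : Disjoint V₂ V₃
    d₂₄ : Disjoint V₂ V₄
    d₃₄ : Disjoint V₃ V₄

_∈E4_ : ∀ {n} → Edge4 n → Complete4Partite n → Set
e ∈E4 H = (∣ V₁ ∩ S ∣ ≡ 1) × (∣ V₂ ∩ S ∣ ≡ 1) × (∣ V₃ ∩ S ∣ ≡ 1) × (∣ V₄ ∩ S ∣ ≡ 1)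
  where open Complete4Partite H
        S = toSubset e

HyperPartition : (n k : ℕ) → Set
HyperPartition n k =
  Σ (Fin k → Complete4Partite n) λ ℋ →
    (e : Edge4 n) →
      (∃ λ i → e ∈E4 ℋ i) ×
      ((i j : Fin k) → e ∈E4 ℋ i → e ∈E4 ℋ j → i ≡ j)

f₄≤ : ℕ → ℚ → Set
f₄≤ n x = Σ ℕ λ k → HyperPartition n k × (ℕ→ℚ k ≤ x)

module Submission where

-- Write s³ < n ≤ m³ with m = s + 1 and cut the vertices 0 … n-1 into t = m² consecutive parts of
-- size m.  Classify a 4-edge a < b < c < d by which consecutive vertices share a part.  When a, b lie in
-- part i and c, d in a later part j, the offsets of {a, b} and {c, d} form a pair of edges of K_m; a
-- partition of E(K_m) × E(K_m) into g(m) blocks E(B₁) × E(B₂) therefore yields, for each i < j, g(m)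
-- complete 4-partite 4-graphs covering these edges exactly once.  Every other edge is covered by a
-- "chain" piece V₁ < V₂ < V₃ < V₄ determined by a few parts and offsets; there are O(m⁵) of them.  Hence
-- f₄(n) ≤ (t choose 2) g(m) + O(m⁵) ≤ α m⁶/2 + O(α m⁵) (using 1 ≤ g(2) ≤ 4α), and m⁶ = (1 + o(1)) n².

open import Defs
open import Data.Nat using (ℕ; NonZero)
open import Data.Product using (Σ; _×_)
open import Relation.Nullary using (Dec)
open import Relation.Binary.PropositionalEquality using (_≡_)

module Subsets where

  open import Data.Nat using (suc; pred)
  open import Data.Fin using (Fin; zero; suc)
  open import Data.Fin.Properties using (suc-injective)
  open import Data.Fin.Subset using (Subset; _∈_; _∉_; ∣_∣; inside; outside)
  open import Data.Vec using ([]; _∷_; tabulate)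
  open import Data.Vec.Properties using (lookup∘tabulate; []=⇒lookup; lookup⇒[]=)
  open import Data.Vec.Base using (here; there)
  open import Data.Product using (Σ; _×_; _,_)
  open import Data.Empty using (⊥; ⊥-elim)
  open import Level using (0ℓ)
  open import Relation.Nullary using (does; yes; no)
  open import Relation.Nullary.Decidable using (dec-true)
  open import Relation.Unary using (Pred; Decidable)
  open import Relation.Binary.PropositionalEquality using (_≡_; refl; cong; trans; sym)

  ∣p∣≡0⇒x∉p : ∀ {n} (p : Subset n) → ∣ p ∣ ≡ 0 → ∀ x → x ∉ p
  ∣p∣≡0⇒x∉p (outside ∷ p) eq zero ()
  ∣p∣≡0⇒x∉p (outside ∷ p) eq (suc x) (there x∈p) = ∣p∣≡0⇒x∉p p eq x x∈p
  ∣p∣≡0⇒x∉p (inside ∷ p) () x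

  x∉p⇒∣p∣≡0 : ∀ {n} (p : Subset n) → (∀ x → x ∉ p) → ∣ p ∣ ≡ 0
  x∉p⇒∣p∣≡0 [] _ = refl
  x∉p⇒∣p∣≡0 (outside ∷ p) empty = x∉p⇒∣p∣≡0 p (λ x x∈p → empty (suc x) (there x∈p))
  x∉p⇒∣p∣≡0 (inside ∷ p) empty = ⊥-elim (empty zero here)

  ∣p∣≡1⇒singleton : ∀ {n} (p : Subset n) → ∣ p ∣ ≡ 1 →
    Σ (Fin n) λ w → w ∈ p × (∀ x → x ∈ p → x ≡ w)
  ∣p∣≡1⇒singleton (outside ∷ p) eq with ∣p∣≡1⇒singleton p eq
  ... | w , w∈p , unique = suc w , there w∈p ,
        λ { zero () ; (suc x) (there x∈p) → cong suc (unique x x∈p) }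
  ∣p∣≡1⇒singleton (inside ∷ p) eq = zero , here ,
    λ { zero _ → refl ; (suc x) (there x∈p) → ⊥-elim (∣p∣≡0⇒x∉p p (cong pred eq) x x∈p) }

  singleton⇒∣p∣≡1 : ∀ {n} (p : Subset n) (w : Fin n) → w ∈ p → (∀ x → x ∈ p → x ≡ w) → ∣ p ∣ ≡ 1
  singleton⇒∣p∣≡1 (outside ∷ p) zero () unique
  singleton⇒∣p∣≡1 (outside ∷ p) (suc w) (there w∈p) unique =
    singleton⇒∣p∣≡1 p w w∈p (λ x x∈p → suc-injective (unique (suc x) (there x∈p)))
  singleton⇒∣p∣≡1 (inside ∷ p) zero _ unique =
    cong suc (x∉p⇒∣p∣≡0 p (λ x x∈p → 0≢suc (unique (suc x) (there x∈p))))
    where 0≢suc : ∀ {k} {x : Fin k} → Fin.suc x ≡ zero → ⊥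
          0≢suc ()
  singleton⇒∣p∣≡1 (inside ∷ p) (suc w) _ unique with unique zero here
  ... | ()

  ⟦_⟧ : ∀ {n} {Q : Pred (Fin n) 0ℓ} → Decidable Q → Subset n
  ⟦ Q? ⟧ = tabulate (λ x → does (Q? x))

  ∈⟦⟧⁺ : ∀ {n} {Q : Pred (Fin n) 0ℓ} (Q? : Decidable Q) {x} → Q x → x ∈ ⟦ Q? ⟧
  ∈⟦⟧⁺ Q? {x} q = lookup⇒[]= x _ (trans (lookup∘tabulate _ x) (dec-true (Q? x) q))

  ∈⟦⟧⁻ : ∀ {n} {Q : Pred (Fin n) 0ℓ} (Q? : Decidable Q) {x} → x ∈ ⟦ Q? ⟧ → Q x
  ∈⟦⟧⁻ Q? {x} x∈ with Q? x | trans (sym (lookup∘tabulate _ x)) ([]=⇒lookup x∈)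
  ... | yes q | _ = q
  ... | no _  | ()

module FourSets {n : ℕ} where

  open import Data.Nat using (_<_; s≤s)
  open import Data.Nat.Properties using (<-trans; <-irrefl; <-asym; <-cmp)
  open import Data.Fin using (Fin; zero; suc; toℕ)
  open import Data.Fin.Properties using (toℕ-injective)
  open import Data.Fin.Subset using (_∈_)
  open import Data.Fin.Subset.Properties using (x∈p∪q⁺; x∈p∪q⁻; x∈⁅x⁆; x∈⁅y⁆⇒x≡y)
  open import Data.Product using (Σ; _,_)
  open import Data.Sum using (inj₁; inj₂)
  open import Data.Empty using (⊥-elim)
  open import Relation.Binary using (tri<; tri≈; tri>)
  open import Relation.Binary.PropositionalEquality using (_≡_; refl)

  vertex : Edge4 n → Fin 4 → Fin n
  vertex ((a , b , c , d) , _) zero = a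
  vertex ((a , b , c , d) , _) (suc zero) = b
  vertex ((a , b , c , d) , _) (suc (suc zero)) = c
  vertex ((a , b , c , d) , _) (suc (suc (suc zero))) = d

  vertex∈toSubset : (e : Edge4 n) → ∀ r → vertex e r ∈ toSubset e
  vertex∈toSubset ((a , b , c , d) , _) zero = x∈p∪q⁺ (inj₁ (x∈⁅x⁆ a))
  vertex∈toSubset ((a , b , c , d) , _) (suc zero) = x∈p∪q⁺ (inj₂ (x∈p∪q⁺ (inj₁ (x∈⁅x⁆ b))))
  vertex∈toSubset ((a , b , c , d) , _) (suc (suc zero)) =
    x∈p∪q⁺ (inj₂ (x∈p∪q⁺ (inj₂ (x∈p∪q⁺ (inj₁ (x∈⁅x⁆ c))))))
  vertex∈toSubset ((a , b , c , d) , _) (suc (suc (suc zero))) =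
    x∈p∪q⁺ (inj₂ (x∈p∪q⁺ (inj₂ (x∈p∪q⁺ (inj₂ (x∈⁅x⁆ d))))))

  toSubset⊆vertices : (e : Edge4 n) → ∀ x → x ∈ toSubset e → Σ (Fin 4) λ r → x ≡ vertex e r
  toSubset⊆vertices ((a , b , c , d) , _) x x∈ with x∈p∪q⁻ _ _ x∈
  ... | inj₁ x∈a = zero , x∈⁅y⁆⇒x≡y a x∈a
  ... | inj₂ x∈′ with x∈p∪q⁻ _ _ x∈′
  ... | inj₁ x∈b = suc zero , x∈⁅y⁆⇒x≡y b x∈b
  ... | inj₂ x∈″ with x∈p∪q⁻ _ _ x∈″
  ... | inj₁ x∈c = suc (suc zero) , x∈⁅y⁆⇒x≡y c x∈c
  ... | inj₂ x∈d = suc (suc (suc zero)) , x∈⁅y⁆⇒x≡y d x∈d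

  vertex-increasing : (e : Edge4 n) → ∀ r s → toℕ r < toℕ s → toℕ (vertex e r) < toℕ (vertex e s)
  vertex-increasing (_ , ab , bc , cd) zero (suc zero) _ = ab
  vertex-increasing (_ , ab , bc , cd) zero (suc (suc zero)) _ = <-trans ab bc
  vertex-increasing (_ , ab , bc , cd) zero (suc (suc (suc zero))) _ = <-trans ab (<-trans bc cd)
  vertex-increasing (_ , ab , bc , cd) (suc zero) (suc (suc zero)) _ = bc
  vertex-increasing (_ , ab , bc , cd) (suc zero) (suc (suc (suc zero))) _ = <-trans bc cd
  vertex-increasing (_ , ab , bc , cd) (suc (suc zero)) (suc (suc (suc zero))) _ = cd
  vertex-increasing e zero zero ()
  vertex-increasing e (suc _) zero ()
  vertex-increasing e (suc zero) (suc zero) (s≤s ())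
  vertex-increasing e (suc (suc _)) (suc zero) (s≤s ())
  vertex-increasing e (suc (suc zero)) (suc (suc zero)) (s≤s (s≤s ()))
  vertex-increasing e (suc (suc (suc zero))) (suc (suc zero)) (s≤s (s≤s ()))
  vertex-increasing e (suc (suc (suc zero))) (suc (suc (suc zero))) (s≤s (s≤s (s≤s ())))

  vertex-reflects-< : (e : Edge4 n) → ∀ r s → toℕ (vertex e r) < toℕ (vertex e s) → toℕ r < toℕ s
  vertex-reflects-< e r s lt with <-cmp (toℕ r) (toℕ s)
  ... | tri< r<s _ _ = r<s
  ... | tri≈ _ r≡s _ rewrite toℕ-injective {i = r} {j = s} r≡s = ⊥-elim (<-irrefl refl lt)
  ... | tri> _ _ s<r = ⊥-elim (<-asym lt (vertex-increasing e s r s<r))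


-- In general e ∈ H iff its vertices can be
-- matched bijectively to the four classes; when the classes are ordered (all of V₁ before all of V₂, ...)
-- the matching is forced, which gives the two concrete criteria used by the construction: "chains"
-- V₁ < V₂ < V₃ < V₄ and "split" graphs V₁, V₂ < V₃, V₄.
module FourPartite {n : ℕ} where

  open import Data.Nat using (_<_; _<?_)
  open import Data.Nat.Properties using (<-irrefl; <-trans)
  open import Data.Fin using (Fin; zero; suc; toℕ)
  open import Data.Fin.Properties using (all?; any?; _≟_)
  open import Data.Fin.Subset using (Subset; _∈_; _∩_; ∣_∣; Nonempty)
  open import Data.Fin.Subset.Properties using (x∈p∩q⁺; x∈p∩q⁻)
  open import Data.Product using (Σ; _×_; _,_; proj₁; proj₂)
  open import Data.Sum using (_⊎_; inj₁; inj₂)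
  open import Data.Empty using (⊥-elim)
  open import Relation.Nullary using (Dec; ¬_)
  open import Relation.Nullary.Decidable using (toWitness; _×-dec_; _⊎-dec_; _→-dec_; ¬?)
  open import Relation.Binary.PropositionalEquality using (_≡_; refl; sym; cong; subst)
  open Complete4Partite
  open Subsets
  open FourSets

  class : Complete4Partite n → Fin 4 → Subset n
  class H zero = V₁ H
  class H (suc zero) = V₂ H
  class H (suc (suc zero)) = V₃ H
  class H (suc (suc (suc zero))) = V₄ H

  classes-disjoint : (H : Complete4Partite n) → ∀ k l x → x ∈ class H k → x ∈ class H l → k ≡ l
  classes-disjoint H zero zero x p q = refl
  classes-disjoint H zero (suc zero) x p q = ⊥-elim (d₁₂ H x p q)
  classes-disjoint H zero (suc (suc zero)) x p q = ⊥-elim (d₁₃ H x p q)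
  classes-disjoint H zero (suc (suc (suc zero))) x p q = ⊥-elim (d₁₄ H x p q)
  classes-disjoint H (suc zero) zero x p q = ⊥-elim (d₁₂ H x q p)
  classes-disjoint H (suc zero) (suc zero) x p q = refl
  classes-disjoint H (suc zero) (suc (suc zero)) x p q = ⊥-elim (d₂₃ H x p q)
  classes-disjoint H (suc zero) (suc (suc (suc zero))) x p q = ⊥-elim (d₂₄ H x p q)
  classes-disjoint H (suc (suc zero)) zero x p q = ⊥-elim (d₁₃ H x q p)
  classes-disjoint H (suc (suc zero)) (suc zero) x p q = ⊥-elim (d₂₃ H x q p)
  classes-disjoint H (suc (suc zero)) (suc (suc zero)) x p q = refl
  classes-disjoint H (suc (suc zero)) (suc (suc (suc zero))) x p q = ⊥-elim (d₃₄ H x p q)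
  classes-disjoint H (suc (suc (suc zero))) zero x p q = ⊥-elim (d₁₄ H x q p)
  classes-disjoint H (suc (suc (suc zero))) (suc zero) x p q = ⊥-elim (d₂₄ H x q p)
  classes-disjoint H (suc (suc (suc zero))) (suc (suc zero)) x p q = ⊥-elim (d₃₄ H x q p)
  classes-disjoint H (suc (suc (suc zero))) (suc (suc (suc zero))) x p q = refl

  Surjective₄ : (Fin 4 → Fin 4) → Set
  Surjective₄ w = ∀ r → Σ (Fin 4) λ k → r ≡ w k

  surjective₄? : ∀ w → Dec (Surjective₄ w)
  surjective₄? w = all? λ r → any? λ k → r ≟ w k

  ∈E4-intro : (H : Complete4Partite n) (e : Edge4 n) (w : Fin 4 → Fin 4) →
    (∀ k → vertex e (w k) ∈ class H k) → Surjective₄ w → e ∈E4 H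
  ∈E4-intro H e w placed onto = meets zero , meets (suc zero) , meets (suc (suc zero)) , meets (suc (suc (suc zero)))
    where
    only : ∀ k x → x ∈ class H k ∩ toSubset e → x ≡ vertex e (w k)
    only k x x∈ with toSubset⊆vertices e x (proj₂ (x∈p∩q⁻ _ _ x∈))
    ... | r , refl with onto r
    ... | l , refl =
      cong (λ z → vertex e (w z)) (classes-disjoint H l k _ (placed l) (proj₁ (x∈p∩q⁻ _ _ x∈)))
    meets : ∀ k → ∣ class H k ∩ toSubset e ∣ ≡ 1
    meets k = singleton⇒∣p∣≡1 _ (vertex e (w k)) (x∈p∩q⁺ (placed k , vertex∈toSubset e (w k))) (only k)

  ∈E4-elim : (H : Complete4Partite n) (e : Edge4 n) → e ∈E4 H →
    Σ (Fin 4 → Fin 4) λ w → (∀ k → vertex e (w k) ∈ class H k)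
  ∈E4-elim H e (m₁ , m₂ , m₃ , m₄) = w , placed
    where
    meets : ∀ k → ∣ class H k ∩ toSubset e ∣ ≡ 1
    meets zero = m₁
    meets (suc zero) = m₂
    meets (suc (suc zero)) = m₃
    meets (suc (suc (suc zero))) = m₄
    witness : ∀ k → Σ (Fin n) λ x → x ∈ class H k × x ∈ toSubset e
    witness k with ∣p∣≡1⇒singleton _ (meets k)
    ... | x , x∈ , _ = x , x∈p∩q⁻ _ _ x∈
    w : Fin 4 → Fin 4
    w k = proj₁ (toSubset⊆vertices e _ (proj₂ (proj₂ (witness k))))
    placed : ∀ k → vertex e (w k) ∈ class H k
    placed k = subst (_∈ class H k) (proj₂ (toSubset⊆vertices e _ (proj₂ (proj₂ (witness k)))))
                     (proj₁ (proj₂ (witness k)))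

  Precedes : Subset n → Subset n → Set
  Precedes X Y = ∀ x y → x ∈ X → y ∈ Y → toℕ x < toℕ y

  precedes⇒disjoint : ∀ {X Y} → Precedes X Y → Disjoint X Y
  precedes⇒disjoint X<Y x x∈X x∈Y = <-irrefl refl (X<Y x x x∈X x∈Y)

  precedes-trans : ∀ {X Y Z} → Precedes X Y → Nonempty Y → Precedes Y Z → Precedes X Z
  precedes-trans X<Y (y , y∈Y) Y<Z x z x∈X z∈Z = <-trans (X<Y x y x∈X y∈Y) (Y<Z y z y∈Y z∈Z)

  PairwiseDisjoint : Subset n → Subset n → Subset n → Subset n → Set
  PairwiseDisjoint V₁ V₂ V₃ V₄ =
    Disjoint V₁ V₂ × Disjoint V₁ V₃ × Disjoint V₁ V₄ × Disjoint V₂ V₃ × Disjoint V₂ V₄ × Disjoint V₃ V₄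

  chain-disjoint : ∀ {V₁ V₂ V₃ V₄} → Precedes V₁ V₂ → Precedes V₂ V₃ → Precedes V₃ V₄ →
    Nonempty V₂ → Nonempty V₃ → PairwiseDisjoint V₁ V₂ V₃ V₄
  chain-disjoint V₁<V₂ V₂<V₃ V₃<V₄ ne₂ ne₃ =
    precedes⇒disjoint V₁<V₂ , precedes⇒disjoint V₁<V₃ ,
    precedes⇒disjoint (precedes-trans V₁<V₃ ne₃ V₃<V₄) ,
    precedes⇒disjoint V₂<V₃ , precedes⇒disjoint (precedes-trans V₂<V₃ ne₃ V₃<V₄) , precedes⇒disjoint V₃<V₄
    where V₁<V₃ = precedes-trans V₁<V₂ ne₂ V₂<V₃

  private
    f0 f1 f2 f3 : Fin 4
    f0 = zero
    f1 = suc zero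
    f2 = suc (suc zero)
    f3 = suc (suc (suc zero))

  -- Two facts about Fin 4, checked exhaustively (abstract, so that the checks are never re-run).
  abstract
    increasing-is-identity : ∀ (a b c d : Fin 4) → toℕ a < toℕ b → toℕ b < toℕ c → toℕ c < toℕ d →
      a ≡ f0 × b ≡ f1 × c ≡ f2 × d ≡ f3
    increasing-is-identity = toWitness {a? = all? λ a → all? λ b → all? λ c → all? λ d →
      (toℕ a <? toℕ b) →-dec (toℕ b <? toℕ c) →-dec (toℕ c <? toℕ d) →-dec
      ((a ≟ f0) ×-dec (b ≟ f1) ×-dec (c ≟ f2) ×-dec (d ≟ f3))} _

    split-is-pairs : ∀ (a b c d : Fin 4) →
      toℕ a < toℕ c → toℕ a < toℕ d → toℕ b < toℕ c → toℕ b < toℕ d → ¬ a ≡ b → ¬ c ≡ d →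
      ((a ≡ f0 × b ≡ f1) ⊎ (a ≡ f1 × b ≡ f0)) × ((c ≡ f2 × d ≡ f3) ⊎ (c ≡ f3 × d ≡ f2))
    split-is-pairs = toWitness {a? = all? λ a → all? λ b → all? λ c → all? λ d →
      (toℕ a <? toℕ c) →-dec (toℕ a <? toℕ d) →-dec (toℕ b <? toℕ c) →-dec (toℕ b <? toℕ d) →-dec
      ¬? (a ≟ b) →-dec ¬? (c ≟ d) →-dec
      ((((a ≟ f0) ×-dec (b ≟ f1)) ⊎-dec ((a ≟ f1) ×-dec (b ≟ f0))) ×-dec
       (((c ≟ f2) ×-dec (d ≟ f3)) ⊎-dec ((c ≟ f3) ×-dec (d ≟ f2))))} _

  ∈E4-chain⁺ : (H : Complete4Partite n) (e : Edge4 n) → (∀ k → vertex e k ∈ class H k) → e ∈E4 H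
  ∈E4-chain⁺ H e placed = ∈E4-intro H e (λ k → k) placed (λ r → r , refl)

  ∈E4-chain⁻ : (H : Complete4Partite n) (e : Edge4 n) → e ∈E4 H →
    Precedes (V₁ H) (V₂ H) → Precedes (V₂ H) (V₃ H) → Precedes (V₃ H) (V₄ H) →
    ∀ k → vertex e k ∈ class H k
  ∈E4-chain⁻ H e e∈H V₁<V₂ V₂<V₃ V₃<V₄ with ∈E4-elim H e e∈H
  ... | w , placed with increasing-is-identity (w f0) (w f1) (w f2) (w f3)
          (vertex-reflects-< e _ _ (V₁<V₂ _ _ (placed f0) (placed f1)))
          (vertex-reflects-< e _ _ (V₂<V₃ _ _ (placed f1) (placed f2)))
          (vertex-reflects-< e _ _ (V₃<V₄ _ _ (placed f2) (placed f3)))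
  ... | w0 , w1 , w2 , w3 = λ
    { zero → subst (λ r → vertex e r ∈ V₁ H) w0 (placed f0)
    ; (suc zero) → subst (λ r → vertex e r ∈ V₂ H) w1 (placed f1)
    ; (suc (suc zero)) → subst (λ r → vertex e r ∈ V₃ H) w2 (placed f2)
    ; (suc (suc (suc zero))) → subst (λ r → vertex e r ∈ V₄ H) w3 (placed f3) }

  OnePerClass : Subset n → Subset n → Fin n → Fin n → Set
  OnePerClass X Y x y = (x ∈ X × y ∈ Y) ⊎ (x ∈ Y × y ∈ X)

  onePerClass⇒nonempty : ∀ {X Y x y} → OnePerClass X Y x y → Nonempty X × Nonempty Y
  onePerClass⇒nonempty (inj₁ (x∈X , y∈Y)) = (_ , x∈X) , (_ , y∈Y)
  onePerClass⇒nonempty (inj₂ (x∈Y , y∈X)) = (_ , y∈X) , (_ , x∈Y)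

  ∈E4-split⁺ : (H : Complete4Partite n) (e : Edge4 n) →
    OnePerClass (V₁ H) (V₂ H) (vertex e f0) (vertex e f1) →
    OnePerClass (V₃ H) (V₄ H) (vertex e f2) (vertex e f3) → e ∈E4 H
  ∈E4-split⁺ H e (inj₁ (a , b)) (inj₁ (c , d)) =
    ∈E4-intro H e (λ k → k) (λ { zero → a ; (suc zero) → b ; (suc (suc zero)) → c ; (suc (suc (suc zero))) → d })
      (toWitness {a? = surjective₄? λ k → k} _)
  ∈E4-split⁺ H e (inj₁ (a , b)) (inj₂ (d , c)) =
    ∈E4-intro H e w (λ { zero → a ; (suc zero) → b ; (suc (suc zero)) → c ; (suc (suc (suc zero))) → d })
      (toWitness {a? = surjective₄? w} _)
    where w : Fin 4 → Fin 4
          w = λ { zero → f0 ; (suc zero) → f1 ; (suc (suc zero)) → f3 ; (suc (suc (suc zero))) → f2 }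
  ∈E4-split⁺ H e (inj₂ (b , a)) (inj₁ (c , d)) =
    ∈E4-intro H e w (λ { zero → a ; (suc zero) → b ; (suc (suc zero)) → c ; (suc (suc (suc zero))) → d })
      (toWitness {a? = surjective₄? w} _)
    where w : Fin 4 → Fin 4
          w = λ { zero → f1 ; (suc zero) → f0 ; (suc (suc zero)) → f2 ; (suc (suc (suc zero))) → f3 }
  ∈E4-split⁺ H e (inj₂ (b , a)) (inj₂ (d , c)) =
    ∈E4-intro H e w (λ { zero → a ; (suc zero) → b ; (suc (suc zero)) → c ; (suc (suc (suc zero))) → d })
      (toWitness {a? = surjective₄? w} _)
    where w : Fin 4 → Fin 4
          w = λ { zero → f1 ; (suc zero) → f0 ; (suc (suc zero)) → f3 ; (suc (suc (suc zero))) → f2 }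

  ∈E4-split⁻ : (H : Complete4Partite n) (e : Edge4 n) → e ∈E4 H →
    Precedes (V₁ H) (V₃ H) → Precedes (V₁ H) (V₄ H) → Precedes (V₂ H) (V₃ H) → Precedes (V₂ H) (V₄ H) →
    OnePerClass (V₁ H) (V₂ H) (vertex e f0) (vertex e f1) ×
    OnePerClass (V₃ H) (V₄ H) (vertex e f2) (vertex e f3)
  ∈E4-split⁻ H e e∈H V₁<V₃ V₁<V₄ V₂<V₃ V₂<V₄ with ∈E4-elim H e e∈H
  ... | w , placed with split-is-pairs (w f0) (w f1) (w f2) (w f3)
          (vertex-reflects-< e _ _ (V₁<V₃ _ _ (placed f0) (placed f2)))
          (vertex-reflects-< e _ _ (V₁<V₄ _ _ (placed f0) (placed f3)))
          (vertex-reflects-< e _ _ (V₂<V₃ _ _ (placed f1) (placed f2)))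
          (vertex-reflects-< e _ _ (V₂<V₄ _ _ (placed f1) (placed f3)))
          (λ eq → d₁₂ H _ (placed f0) (subst (λ r → vertex e r ∈ V₂ H) (sym eq) (placed f1)))
          (λ eq → d₃₄ H _ (placed f2) (subst (λ r → vertex e r ∈ V₄ H) (sym eq) (placed f3)))
  ... | first , second =
    pair (V₁ H) (V₂ H) (placed f0) (placed f1) first , pair (V₃ H) (V₄ H) (placed f2) (placed f3) second
    where
    pair : ∀ (X Y : Subset n) {k l r s} → vertex e (w k) ∈ X → vertex e (w l) ∈ Y →
      (w k ≡ r × w l ≡ s) ⊎ (w k ≡ s × w l ≡ r) → OnePerClass X Y (vertex e r) (vertex e s)
    pair X Y x∈X y∈Y (inj₁ (refl , refl)) = inj₁ (x∈X , y∈Y)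
    pair X Y x∈X y∈Y (inj₂ (refl , refl)) = inj₂ (y∈Y , x∈X)

module Enumeration where

  open import Data.Nat using (zero; suc; _+_; _*_; _≤_; _<_; z≤n)
  open import Data.Nat.Properties using (*-distribˡ-+; +-monoʳ-≤; n≤1+n; module ≤-Reasoning)
  open import Data.Nat.ListAction using (sum)
  open import Data.Nat.Tactic.RingSolver using (solve-∀)
  open import Data.Fin using (Fin)
  open import Data.List using (List; []; _∷_; _++_; map; concatMap; cartesianProduct; downFrom; lookup; length)
  open import Data.List.Properties using (length-++; length-map; length-downFrom)
  open import Data.List.Relation.Unary.All as All using ()
  open import Data.List.Relation.Unary.Unique.Propositional using (Unique; []; _∷_)
  open import Data.List.Relation.Unary.Unique.Propositional.Properties using (++⁺; map⁺; downFrom⁺)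
  open import Data.List.Membership.Propositional using (_∈_; find; lose)
  open import Data.List.Membership.Propositional.Properties
    using (∈-lookup; ∈-concatMap⁺; ∈-concatMap⁻; ∈-map⁺; ∈-map⁻; ∈-downFrom⁺)
  open import Data.Product using (_×_; _,_; proj₂)
  open import Data.Empty using (⊥; ⊥-elim)
  open import Relation.Binary.PropositionalEquality using (_≡_; refl; sym; trans; cong; cong₂)

  lookup-injective : ∀ {A : Set} {xs : List A} → Unique xs → ∀ i j → lookup xs i ≡ lookup xs j → i ≡ j
  lookup-injective (_ ∷ _) Fin.zero Fin.zero _ = refl
  lookup-injective (x∉xs ∷ _) Fin.zero (Fin.suc j) eq = ⊥-elim (All.lookup x∉xs (∈-lookup j) eq)
  lookup-injective (x∉xs ∷ _) (Fin.suc i) Fin.zero eq = ⊥-elim (All.lookup x∉xs (∈-lookup i) (sym eq))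
  lookup-injective (_ ∷ unique) (Fin.suc i) (Fin.suc j) eq = cong Fin.suc (lookup-injective unique i j eq)

  concatMap⁺ : ∀ {A B : Set} (key : B → A) {f : A → List B} {xs : List A} →
    Unique xs → (∀ x → Unique (f x)) → (∀ x {y} → y ∈ f x → key y ≡ x) → Unique (concatMap f xs)
  concatMap⁺ key [] _ _ = []
  concatMap⁺ key {f} {x ∷ xs} (x∉xs ∷ unique) unique-f keyed =
    ++⁺ (unique-f x) (concatMap⁺ key unique unique-f keyed) disjoint
    where
    disjoint : ∀ {y} → y ∈ f x × y ∈ concatMap f xs → ⊥
    disjoint (y∈fx , y∈rest) with find (∈-concatMap⁻ f y∈rest)
    ... | x′ , x′∈xs , y∈fx′ = All.lookup x∉xs x′∈xs (trans (sym (keyed x y∈fx)) (keyed x′ y∈fx′))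

  map-keyed : ∀ {A B C : Set} (key : B → C) (f : A → B) {k xs} → (∀ x → key (f x) ≡ k) →
    ∀ {y} → y ∈ map f xs → key y ≡ k
  map-keyed key f keyed y∈ with ∈-map⁻ f y∈
  ... | x , _ , refl = keyed x

  length-concatMap : ∀ {A B : Set} (f : A → List B) xs → length (concatMap f xs) ≡ sum (map (λ x → length (f x)) xs)
  length-concatMap f [] = refl
  length-concatMap f (x ∷ xs) = trans (length-++ (f x)) (cong (length (f x) +_) (length-concatMap f xs))

  length-cartesianProduct : ∀ {A B : Set} (xs : List A) (ys : List B) →
    length (cartesianProduct xs ys) ≡ length xs * length ys
  length-cartesianProduct [] ys = refl
  length-cartesianProduct (x ∷ xs) ys = trans (length-++ (map (x ,_) ys))
    (cong₂ _+_ (length-map (x ,_) ys) (length-cartesianProduct xs ys))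

  increasingPairs : ℕ → List (ℕ × ℕ)
  increasingPairs t = concatMap (λ j → map (_, j) (downFrom j)) (downFrom t)

  increasingPairs-unique : ∀ t → Unique (increasingPairs t)
  increasingPairs-unique t = concatMap⁺ proj₂ (downFrom⁺ t)
    (λ j → map⁺ (λ { refl → refl }) (downFrom⁺ j)) (λ j → map-keyed proj₂ (_, j) (λ _ → refl))

  ∈-increasingPairs : ∀ {i j t} → i < j → j < t → (i , j) ∈ increasingPairs t
  ∈-increasingPairs {i} {j} i<j j<t =
    ∈-concatMap⁺ (λ j′ → map (_, j′) (downFrom j′)) (lose (∈-downFrom⁺ j<t) (∈-map⁺ (_, j) (∈-downFrom⁺ i<j)))

  2*length-increasingPairs : ∀ t → 2 * length (increasingPairs t) ≤ t * t
  2*length-increasingPairs zero = z≤n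
  2*length-increasingPairs (suc t) = begin
      2 * length (map (_, t) (downFrom t) ++ increasingPairs t)
        ≡⟨ cong (2 *_) (trans (length-++ (map (_, t) (downFrom t)))
                              (cong (_+ P) (trans (length-map (_, t) (downFrom t)) (length-downFrom t)))) ⟩
      2 * (t + P)     ≡⟨ *-distribˡ-+ 2 t P ⟩
      2 * t + 2 * P   ≤⟨ +-monoʳ-≤ (2 * t) (2*length-increasingPairs t) ⟩
      2 * t + t * t   ≤⟨ n≤1+n _ ⟩
      suc (2 * t + t * t) ≡⟨ square-suc t ⟩
      suc t * suc t   ∎
    where
    open ≤-Reasoning
    P : ℕ
    P = length (increasingPairs t)
    square-suc : ∀ t → suc (2 * t + t * t) ≡ suc t * suc t
    square-suc = solve-∀

module PartitionFromCodes {n : ℕ} {Code : Set}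
    (Valid : Code → Set) (valid? : ∀ c → Dec (Valid c))
    (piece : (c : Code) → Valid c → Complete4Partite n)
    (code : Edge4 n → Code)
    (complete : ∀ e → Valid (code e) × (∀ v → e ∈E4 piece (code e) v))
    (sound : ∀ e c v → e ∈E4 piece c v → c ≡ code e) where

  open import Data.Fin using (Fin)
  open import Data.List using (List; filter; lookup; length)
  open import Data.List.Relation.Unary.Any using (index)
  open import Data.List.Relation.Unary.Any.Properties using (lookup-index)
  open import Data.List.Relation.Unary.Unique.Propositional using (Unique)
  open import Data.List.Relation.Unary.Unique.Propositional.Properties using (filter⁺)
  open import Data.List.Membership.Propositional using (_∈_)
  open import Data.List.Membership.Propositional.Properties using (∈-lookup; ∈-filter⁺; ∈-filter⁻)
  open import Data.Product using (_,_; proj₁; proj₂)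
  open import Relation.Binary.PropositionalEquality using (sym; trans; subst)
  open Enumeration using (lookup-injective)

  partition : (codes : List Code) → Unique codes → (∀ e → code e ∈ codes) →
    HyperPartition n (length (filter valid? codes))
  partition codes unique listed = ℋ , λ e → exists e , unique-piece e
    where
    kept : List Code
    kept = filter valid? codes
    ℋ : Fin (length kept) → Complete4Partite n
    ℋ i = piece (lookup kept i) (proj₂ (∈-filter⁻ valid? {xs = codes} (∈-lookup i)))
    exists : ∀ e → Σ (Fin (length kept)) λ i → e ∈E4 ℋ i
    exists e = i , subst (λ c → ∀ v → e ∈E4 piece c v) (lookup-index kept∋e) (proj₂ (complete e)) _
      where kept∋e : code e ∈ kept
            kept∋e = ∈-filter⁺ valid? (listed e) (proj₁ (complete e))
            i : Fin (length kept)
            i = index kept∋e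
    unique-piece : ∀ e i j → e ∈E4 ℋ i → e ∈E4 ℋ j → i ≡ j
    unique-piece e i j e∈i e∈j =
      lookup-injective (filter⁺ valid? unique) i j (trans (sound e _ _ e∈i) (sym (sound e _ _ e∈j)))

-- Vertices 0 … n-1 cut into consecutive parts of size m: vertex u lies in part u / m at offset u % m,
-- and the vertex order is the lexicographic order on (part, offset).
module PartsAndOffsets (m : ℕ) {{_ : NonZero m}} where

  open import Data.Nat using (_+_; _*_; _<_; _/_; _%_)
  open import Data.Nat.Properties using (<-cmp; <-irrefl; <-asym; <⇒≤; <⇒≱; +-monoˡ-<; module ≤-Reasoning)
  open import Data.Nat.DivMod using (m≡m%n+[m/n]*n; /-monoˡ-≤)
  open import Data.Empty using (⊥-elim)
  open import Relation.Nullary using (¬_)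
  open import Relation.Binary using (tri<; tri≈; tri>)
  open import Relation.Binary.PropositionalEquality using (refl; sym; cong; cong₂; module ≡-Reasoning)

  part-< : ∀ {u w} → u / m < w / m → u < w
  part-< {u} {w} lt with <-cmp u w
  ... | tri< u<w _ _ = u<w
  ... | tri≈ _ refl _ = ⊥-elim (<-irrefl refl lt)
  ... | tri> _ _ w<u = ⊥-elim (<⇒≱ lt (/-monoˡ-≤ m (<⇒≤ w<u)))

  offset-< : ∀ {u w} → u / m ≡ w / m → u % m < w % m → u < w
  offset-< {u} {w} same lt = begin-strict
      u                   ≡⟨ m≡m%n+[m/n]*n u m ⟩
      u % m + (u / m) * m <⟨ +-monoˡ-< ((u / m) * m) lt ⟩
      w % m + (u / m) * m ≡⟨ cong (λ p → w % m + p * m) same ⟩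
      w % m + (w / m) * m ≡⟨ sym (m≡m%n+[m/n]*n w m) ⟩
      w                   ∎
    where open ≤-Reasoning

  same-position : ∀ {u w} → u / m ≡ w / m → u % m ≡ w % m → u ≡ w
  same-position {u} {w} same-part same-offset = begin
      u                   ≡⟨ m≡m%n+[m/n]*n u m ⟩
      u % m + (u / m) * m ≡⟨ cong₂ (λ o p → o + p * m) same-offset same-part ⟩
      w % m + (w / m) * m ≡⟨ sym (m≡m%n+[m/n]*n w m) ⟩
      w                   ∎
    where open ≡-Reasoning

  <-same-part : ∀ {u w} → u < w → u / m ≡ w / m → u % m < w % m
  <-same-part {u} {w} u<w same with <-cmp (u % m) (w % m)
  ... | tri< lt _ _ = lt
  ... | tri≈ _ eq _ = ⊥-elim (<-irrefl (same-position same eq) u<w)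
  ... | tri> _ _ gt = ⊥-elim (<-asym u<w (offset-< (sym same) gt))

  <-other-part : ∀ {u w} → u < w → ¬ u / m ≡ w / m → u / m < w / m
  <-other-part {u} {w} u<w different with <-cmp (u / m) (w / m)
  ... | tri< lt _ _ = lt
  ... | tri≈ _ eq _ = ⊥-elim (different eq)
  ... | tri> _ _ gt = ⊥-elim (<-asym u<w (part-< gt))

module CodeCount where

  open import Data.Nat using (_+_; _*_)

  chainCodes : ℕ → ℕ → ℕ
  chainCodes t m = t * t + t * (m * t) + t * m + t * (t * m) + t * (m * m) + t * (m * m) + t * (m * (m * m))

-- A 4-edge a < b < c < d is
-- classified by which consecutive vertices share a part; the digits in the code names below are the lengths
-- of these runs (c211: a, b share a part, c and d lie in two further parts).  All but one type are covered
-- by "chain" pieces with classes V₁ < V₂ < V₃ < V₄, indexed by a few parts and offsets.  The type 22 (a, b in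
-- part i and c, d in a later part j) is covered, for each i < j, by the blocks E(B₁) × E(B₂) of a partition
-- of E(K_m) × E(K_m): the block splits {a, b} by B₁ and {c, d} by B₂ through their offsets.
module Construction (m t n : ℕ) {{_ : NonZero m}} (n≤tm : n Data.Nat.≤ t Data.Nat.* m)
                    (kg : ℕ) (blocks : BlockPartition m kg) where

  open import Data.Nat using (zero; suc; _+_; _*_; _≤_; _<_; _/_; _%_; _<?_; _≟_)
  open import Data.Nat.Properties using (<⇒≢; ≡-irrelevant; <-≤-trans; ≤-trans; ≤-reflexive)
  open import Data.Nat.DivMod using (m%n<n; m<n*o⇒m/o<n)
  open import Data.Fin using (Fin; zero; suc; toℕ; fromℕ<)
  open import Data.Fin.Properties using (toℕ-fromℕ<; toℕ<n; all?)
  open import Data.Fin.Subset using (Subset; _∈_; Nonempty)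
  open import Data.Fin.Subset.Properties using (nonempty?; _∈?_)
  open import Data.Vec using (Vec; []; _∷_; lookup)
  open import Data.List using (List; map; cartesianProduct; downFrom; allFin; concatMap; filter; length)
  open import Data.List.Properties using (length-map; length-downFrom; length-tabulate; length-filter; map-cong)
  open import Data.Nat.ListAction using (sum)
  open import Data.Nat.Tactic.RingSolver using (solve-∀)
  open import Data.List.Relation.Unary.Unique.Propositional using (Unique)
  open import Data.List.Relation.Unary.Unique.Propositional.Properties
    using (map⁺; cartesianProduct⁺; downFrom⁺; allFin⁺)
  open import Data.List.Membership.Propositional using (lose) renaming (_∈_ to _∈ₗ_)
  open import Data.List.Membership.Propositional.Properties
    using (∈-map⁺; ∈-cartesianProduct⁺; ∈-downFrom⁺; ∈-allFin; ∈-concatMap⁺)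
  open import Data.Product using (_,_; proj₁; proj₂)
  open import Data.Sum using (_⊎_; inj₁; inj₂)
  open import Data.Unit using (⊤; tt)
  open import Data.Empty using (⊥)
  open import Relation.Nullary using (yes; no; ¬_)
  open import Relation.Nullary.Decidable using (_×-dec_; dec-no; dec-yes-irr)
  open import Relation.Binary.PropositionalEquality using (refl; sym; trans; cong; cong₂; subst; subst₂)
  open CompleteBipartite
  open Subsets
  open FourSets
  open FourPartite
  open PartsAndOffsets m
  open Enumeration
  open CodeCount

  𝓑 : Fin kg → Block m
  𝓑 = proj₁ blocks

  part offset : Fin n → ℕ
  part v = toℕ v / m
  offset v = toℕ v % m

  offsetFin : Fin n → Fin m
  offsetFin v = fromℕ< (m%n<n (toℕ v) m)

  part<t : ∀ v → part v < t
  part<t v = m<n*o⇒m/o<n (<-≤-trans (toℕ<n v) n≤tm)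

  offset<m : ∀ v → offset v < m
  offset<m v = m%n<n (toℕ v) m

  -- Regions: the vertex sets that serve as classes of the pieces.
  data Region : Set where
    partsBefore wholePart partsAfter : ℕ → Region
    point laterInPart : ℕ → ℕ → Region
    offsetsIn : ℕ → Subset m → Region

  _∋_ : Region → Fin n → Set
  partsBefore i ∋ v = part v < i
  wholePart i ∋ v = part v ≡ i
  partsAfter i ∋ v = i < part v
  point i x ∋ v = part v ≡ i × offset v ≡ x
  laterInPart i x ∋ v = part v ≡ i × x < offset v
  offsetsIn i X ∋ v = part v ≡ i × offsetFin v ∈ X

  _∋?_ : ∀ R v → Dec (R ∋ v)
  partsBefore i ∋? v = part v <? i
  wholePart i ∋? v = part v ≟ i
  partsAfter i ∋? v = i <? part v
  point i x ∋? v = (part v ≟ i) ×-dec (offset v ≟ x)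
  laterInPart i x ∋? v = (part v ≟ i) ×-dec (x <? offset v)
  offsetsIn i X ∋? v = (part v ≟ i) ×-dec (offsetFin v ∈? X)

  vertices : Region → Subset n
  vertices R = ⟦ R ∋?_ ⟧

  data Code : Set where
    c1111 : ℕ → ℕ → Code               -- parts of b and of c
    c211  : ℕ → ℕ → ℕ → Code           -- part and offset of a, part of c
    c121  : ℕ → ℕ → Code               -- part and offset of b
    c112  : ℕ → ℕ → ℕ → Code           -- part of b, part and offset of c
    c31   : ℕ → ℕ → ℕ → Code           -- part of a, offsets of a and b
    c13   : ℕ → ℕ → ℕ → Code           -- part of b, offsets of b and c
    c22   : ℕ → ℕ → Fin kg → Code      -- parts of a and c, the block containing ({a,b} , {c,d})
    c4    : ℕ → ℕ → ℕ → ℕ → Code       -- part of a, offsets of a, b and c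

  regions : Code → Vec Region 4
  regions (c1111 j k) = partsBefore j ∷ wholePart j ∷ wholePart k ∷ partsAfter k ∷ []
  regions (c211 i x k) = point i x ∷ laterInPart i x ∷ wholePart k ∷ partsAfter k ∷ []
  regions (c121 i x) = partsBefore i ∷ point i x ∷ laterInPart i x ∷ partsAfter i ∷ []
  regions (c112 j i x) = partsBefore j ∷ wholePart j ∷ point i x ∷ laterInPart i x ∷ []
  regions (c31 i x y) = point i x ∷ point i y ∷ laterInPart i y ∷ partsAfter i ∷ []
  regions (c13 i x y) = partsBefore i ∷ point i x ∷ point i y ∷ laterInPart i y ∷ []
  regions (c22 i j β) = offsetsIn i (X (proj₁ (𝓑 β))) ∷ offsetsIn i (Y (proj₁ (𝓑 β))) ∷
                        offsetsIn j (X (proj₂ (𝓑 β))) ∷ offsetsIn j (Y (proj₂ (𝓑 β))) ∷ []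
  regions (c4 i x y z) = point i x ∷ point i y ∷ point i z ∷ laterInPart i z ∷ []

  region : Code → Fin 4 → Region
  region c k = lookup (regions c) k

  Ordered : Code → Set
  Ordered (c1111 j k) = j < k
  Ordered (c211 i x k) = i < k
  Ordered (c121 i x) = ⊤
  Ordered (c112 j i x) = j < i
  Ordered (c31 i x y) = x < y
  Ordered (c13 i x y) = x < y
  Ordered (c22 i j β) = i < j
  Ordered (c4 i x y z) = x < y × y < z

  ordered? : ∀ c → Dec (Ordered c)
  ordered? (c1111 j k) = j <? k
  ordered? (c211 i x k) = i <? k
  ordered? (c121 i x) = yes tt
  ordered? (c112 j i x) = j <? i
  ordered? (c31 i x y) = x <? y
  ordered? (c13 i x y) = x <? y
  ordered? (c22 i j β) = i <? j
  ordered? (c4 i x y z) = (x <? y) ×-dec (y <? z)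

  Valid : Code → Set
  Valid c = Ordered c × (∀ k → Nonempty (vertices (region c k)))

  valid? : ∀ c → Dec (Valid c)
  valid? c = ordered? c ×-dec all? (λ k → nonempty? (vertices (region c k)))

  _≺_ : Region → Region → Set
  R ≺ S = ∀ x y → R ∋ x → S ∋ y → toℕ x < toℕ y

  ≺⇒Precedes : ∀ {R S} → R ≺ S → Precedes (vertices R) (vertices S)
  ≺⇒Precedes {R} {S} R≺S x y x∈R y∈S = R≺S x y (∈⟦⟧⁻ (R ∋?_) x∈R) (∈⟦⟧⁻ (S ∋?_) y∈S)

  private
    ≡-<-≡ : ∀ {a b c d : ℕ} → a ≡ b → b < c → d ≡ c → a < d
    ≡-<-≡ refl lt refl = lt

  partsBefore≺wholePart : ∀ i → partsBefore i ≺ wholePart i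
  partsBefore≺wholePart i x y x∈ y∈ = part-< (≡-<-≡ refl x∈ y∈)
  partsBefore≺point : ∀ i z → partsBefore i ≺ point i z
  partsBefore≺point i z x y x∈ (y∈ , _) = part-< (≡-<-≡ refl x∈ y∈)
  wholePart≺wholePart : ∀ {j k} → j < k → wholePart j ≺ wholePart k
  wholePart≺wholePart j<k x y x∈ y∈ = part-< (≡-<-≡ x∈ j<k y∈)
  wholePart≺partsAfter : ∀ k → wholePart k ≺ partsAfter k
  wholePart≺partsAfter k x y x∈ y∈ = part-< (≡-<-≡ x∈ y∈ refl)
  wholePart≺point : ∀ {j i} z → j < i → wholePart j ≺ point i z
  wholePart≺point z j<i x y x∈ (y∈ , _) = part-< (≡-<-≡ x∈ j<i y∈)
  laterInPart≺wholePart : ∀ {i k} z → i < k → laterInPart i z ≺ wholePart k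
  laterInPart≺wholePart z i<k x y (x∈ , _) y∈ = part-< (≡-<-≡ x∈ i<k y∈)
  laterInPart≺partsAfter : ∀ i z → laterInPart i z ≺ partsAfter i
  laterInPart≺partsAfter i z x y (x∈ , _) y∈ = part-< (≡-<-≡ x∈ y∈ refl)
  offsetsIn≺offsetsIn : ∀ {i j} X Y → i < j → offsetsIn i X ≺ offsetsIn j Y
  offsetsIn≺offsetsIn X Y i<j x y (x∈ , _) (y∈ , _) = part-< (≡-<-≡ x∈ i<j y∈)
  point≺laterInPart : ∀ i z → point i z ≺ laterInPart i z
  point≺laterInPart i z x y (xp , xo) (yp , yo) = offset-< (trans xp (sym yp)) (≡-<-≡ xo yo refl)
  point≺point : ∀ i {z w} → z < w → point i z ≺ point i w
  point≺point i z<w x y (xp , xo) (yp , yo) = offset-< (trans xp (sym yp)) (≡-<-≡ xo z<w yo)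

  IsChainCode : Code → Set
  IsChainCode (c22 _ _ _) = ⊥
  IsChainCode _ = ⊤

  Chain : Code → Set
  Chain c = region c zero ≺ region c (suc zero) × region c (suc zero) ≺ region c (suc (suc zero)) ×
            region c (suc (suc zero)) ≺ region c (suc (suc (suc zero)))

  chain : ∀ c → Ordered c → IsChainCode c → Chain c
  chain (c1111 j k) j<k _ = partsBefore≺wholePart j , wholePart≺wholePart j<k , wholePart≺partsAfter k
  chain (c211 i x k) i<k _ = point≺laterInPart i x , laterInPart≺wholePart x i<k , wholePart≺partsAfter k
  chain (c121 i x) _ _ = partsBefore≺point i x , point≺laterInPart i x , laterInPart≺partsAfter i x
  chain (c112 j i x) j<i _ = partsBefore≺wholePart j , wholePart≺point x j<i , point≺laterInPart i x
  chain (c31 i x y) x<y _ = point≺point i x<y , point≺laterInPart i y , laterInPart≺partsAfter i y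
  chain (c13 i x y) x<y _ = partsBefore≺point i x , point≺point i x<y , point≺laterInPart i y
  chain (c4 i x y z) (x<y , y<z) _ = point≺point i x<y , point≺point i y<z , point≺laterInPart i z

  classOf : Code → Fin 4 → Subset n
  classOf c k = vertices (region c k)

  ∈classOf : ∀ c k {x} → region c k ∋ x → x ∈ classOf c k
  ∈classOf c k = ∈⟦⟧⁺ (region c k ∋?_)

  ∈classOf⁻ : ∀ c k {x} → x ∈ classOf c k → region c k ∋ x
  ∈classOf⁻ c k = ∈⟦⟧⁻ (region c k ∋?_)

  RegionsDisjoint : Code → Set
  RegionsDisjoint c = PairwiseDisjoint (classOf c zero) (classOf c (suc zero))
                                       (classOf c (suc (suc zero))) (classOf c (suc (suc (suc zero))))

  chain-regions-disjoint : ∀ c → Valid c → IsChainCode c → RegionsDisjoint c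
  chain-regions-disjoint c (ord , nonempty) isChain =
    let (r₀≺r₁ , r₁≺r₂ , r₂≺r₃) = chain c ord isChain in
    chain-disjoint (≺⇒Precedes r₀≺r₁) (≺⇒Precedes r₁≺r₂) (≺⇒Precedes r₂≺r₃)
                   (nonempty (suc zero)) (nonempty (suc (suc zero)))

  sides-disjoint : ∀ i (B : CompleteBipartite m) →
    Disjoint (vertices (offsetsIn i (X B))) (vertices (offsetsIn i (Y B)))
  sides-disjoint i B v v∈X v∈Y =
    disjoint B (offsetFin v) (proj₂ (∈⟦⟧⁻ (offsetsIn i (X B) ∋?_) v∈X)) (proj₂ (∈⟦⟧⁻ (offsetsIn i (Y B) ∋?_) v∈Y))

  regions-disjoint : ∀ c → Valid c → RegionsDisjoint c
  regions-disjoint (c22 i j β) (i<j , _) =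
    sides-disjoint i B₁ , across (X B₁) (X B₂) , across (X B₁) (Y B₂) ,
    across (Y B₁) (X B₂) , across (Y B₁) (Y B₂) , sides-disjoint j B₂
    where
    B₁ B₂ : CompleteBipartite m
    B₁ = proj₁ (𝓑 β)
    B₂ = proj₂ (𝓑 β)
    across : ∀ P Q → Disjoint (vertices (offsetsIn i P)) (vertices (offsetsIn j Q))
    across P Q = precedes⇒disjoint (≺⇒Precedes {offsetsIn i P} {offsetsIn j Q} (offsetsIn≺offsetsIn P Q i<j))
  regions-disjoint c@(c1111 _ _) v = chain-regions-disjoint c v tt
  regions-disjoint c@(c211 _ _ _) v = chain-regions-disjoint c v tt
  regions-disjoint c@(c121 _ _) v = chain-regions-disjoint c v tt
  regions-disjoint c@(c112 _ _ _) v = chain-regions-disjoint c v tt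
  regions-disjoint c@(c31 _ _ _) v = chain-regions-disjoint c v tt
  regions-disjoint c@(c13 _ _ _) v = chain-regions-disjoint c v tt
  regions-disjoint c@(c4 _ _ _ _) v = chain-regions-disjoint c v tt

  piece : (c : Code) → Valid c → Complete4Partite n
  piece c v =
    let (d₁₂ , d₁₃ , d₁₄ , d₂₃ , d₂₄ , d₃₄) = regions-disjoint c v
        nonempty = proj₂ v in
    record
      { V₁ = classOf c zero ; V₂ = classOf c (suc zero)
      ; V₃ = classOf c (suc (suc zero)) ; V₄ = classOf c (suc (suc (suc zero)))
      ; ne₁ = nonempty zero ; ne₂ = nonempty (suc zero)
      ; ne₃ = nonempty (suc (suc zero)) ; ne₄ = nonempty (suc (suc (suc zero)))
      ; d₁₂ = d₁₂ ; d₁₃ = d₁₃ ; d₁₄ = d₁₄ ; d₂₃ = d₂₃ ; d₂₄ = d₂₄ ; d₃₄ = d₃₄ }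

  offsetEdge : ∀ (u w : Fin n) → toℕ u < toℕ w → part u ≡ part w → Edge m
  offsetEdge u w u<w same = (offsetFin u , offsetFin w) ,
    subst₂ _<_ (sym (toℕ-fromℕ< (offset<m u))) (sym (toℕ-fromℕ< (offset<m w))) (<-same-part u<w same)

  blockOf : Edge m × Edge m → Fin kg
  blockOf ef = proj₁ (proj₁ (proj₂ blocks ef))

  ∈blockOf : ∀ ef → ef ∈Block 𝓑 (blockOf ef)
  ∈blockOf ef = proj₂ (proj₁ (proj₂ blocks ef))

  blockOf-unique : ∀ ef β → ef ∈Block 𝓑 β → blockOf ef ≡ β
  blockOf-unique ef β ef∈β = proj₂ (proj₂ blocks ef) _ β (∈blockOf ef) ef∈β

  codeFrom : (a b c d : Fin n) → toℕ a < toℕ b → toℕ c < toℕ d →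
    Dec (part a ≡ part b) → Dec (part b ≡ part c) → Dec (part c ≡ part d) → Code
  codeFrom a b c d _ _ (no _) (no _) (no _) = c1111 (part b) (part c)
  codeFrom a b c d _ _ (yes _) (no _) (no _) = c211 (part a) (offset a) (part c)
  codeFrom a b c d _ _ (no _) (yes _) (no _) = c121 (part b) (offset b)
  codeFrom a b c d _ _ (no _) (no _) (yes _) = c112 (part b) (part c) (offset c)
  codeFrom a b c d _ _ (yes _) (yes _) (no _) = c31 (part a) (offset a) (offset b)
  codeFrom a b c d _ _ (no _) (yes _) (yes _) = c13 (part b) (offset b) (offset c)
  codeFrom a b c d ab cd (yes a~b) (no _) (yes c~d) =
    c22 (part a) (part c) (blockOf (offsetEdge a b ab a~b , offsetEdge c d cd c~d))
  codeFrom a b c d _ _ (yes _) (yes _) (yes _) = c4 (part a) (offset a) (offset b) (offset c)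

  code : Edge4 n → Code
  code ((a , b , c , d) , ab , bc , cd) = codeFrom a b c d ab cd (part a ≟ part b) (part b ≟ part c) (part c ≟ part d)

  Covers : Code → Edge4 n → Set
  Covers c e = Valid c × (∀ v → e ∈E4 piece c v)

  placed-covers : ∀ c (e : Edge4 n) → Ordered c →
    region c zero ∋ vertex e zero → region c (suc zero) ∋ vertex e (suc zero) →
    region c (suc (suc zero)) ∋ vertex e (suc (suc zero)) →
    region c (suc (suc (suc zero))) ∋ vertex e (suc (suc (suc zero))) → Covers c e
  placed-covers c e ord r₀ r₁ r₂ r₃ =
    (ord , λ k → vertex e k , ∈classOf c k (inRegion k)) , λ v → ∈E4-chain⁺ (piece c v) e λ
      { zero → ∈classOf c zero r₀ ; (suc zero) → ∈classOf c (suc zero) r₁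
      ; (suc (suc zero)) → ∈classOf c (suc (suc zero)) r₂ ; (suc (suc (suc zero))) → ∈classOf c (suc (suc (suc zero))) r₃ }
    where
    inRegion : ∀ k → region c k ∋ vertex e k
    inRegion zero = r₀
    inRegion (suc zero) = r₁
    inRegion (suc (suc zero)) = r₂
    inRegion (suc (suc (suc zero))) = r₃

  Across : CompleteBipartite m → Fin m → Fin m → Set
  Across B x y = (x ∈ X B × y ∈ Y B) ⊎ (x ∈ Y B × y ∈ X B)

  sides⁺ : ∀ {i u w} (B : CompleteBipartite m) →
    part u ≡ i → part w ≡ i → Across B (offsetFin u) (offsetFin w) →
    OnePerClass (vertices (offsetsIn i (X B))) (vertices (offsetsIn i (Y B))) u w
  sides⁺ {i} B pu pw (inj₁ (u∈X , w∈Y)) =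
    inj₁ (∈⟦⟧⁺ (offsetsIn i (X B) ∋?_) (pu , u∈X) , ∈⟦⟧⁺ (offsetsIn i (Y B) ∋?_) (pw , w∈Y))
  sides⁺ {i} B pu pw (inj₂ (u∈Y , w∈X)) =
    inj₂ (∈⟦⟧⁺ (offsetsIn i (Y B) ∋?_) (pu , u∈Y) , ∈⟦⟧⁺ (offsetsIn i (X B) ∋?_) (pw , w∈X))

  sides⁻ : ∀ {i u w} (B : CompleteBipartite m) →
    OnePerClass (vertices (offsetsIn i (X B))) (vertices (offsetsIn i (Y B))) u w →
    part u ≡ i × part w ≡ i × Across B (offsetFin u) (offsetFin w)
  sides⁻ {i} B (inj₁ (u∈X , w∈Y)) with ∈⟦⟧⁻ (offsetsIn i (X B) ∋?_) u∈X | ∈⟦⟧⁻ (offsetsIn i (Y B) ∋?_) w∈Y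
  ... | pu , u∈X′ | pw , w∈Y′ = pu , pw , inj₁ (u∈X′ , w∈Y′)
  sides⁻ {i} B (inj₂ (u∈Y , w∈X)) with ∈⟦⟧⁻ (offsetsIn i (Y B) ∋?_) u∈Y | ∈⟦⟧⁻ (offsetsIn i (X B) ∋?_) w∈X
  ... | pu , u∈Y′ | pw , w∈X′ = pu , pw , inj₂ (u∈Y′ , w∈X′)

  module _ (a b c d : Fin n) (ab : toℕ a < toℕ b) (bc : toℕ b < toℕ c) (cd : toℕ c < toℕ d) where
    private
      e : Edge4 n
      e = (a , b , c , d) , ab , bc , cd

    covers-from : ∀ x y z → Covers (codeFrom a b c d ab cd x y z) e
    covers-from (no a≁b) (no b≁c) (no c≁d) =
      placed-covers (c1111 (part b) (part c)) e (<-other-part bc b≁c)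
        (<-other-part ab a≁b) refl refl (<-other-part cd c≁d)
    covers-from (yes a~b) (no b≁c) (no c≁d) =
      placed-covers (c211 (part a) (offset a) (part c)) e (≡-<-≡ a~b (<-other-part bc b≁c) refl)
        (refl , refl) (sym a~b , <-same-part ab a~b) refl (<-other-part cd c≁d)
    covers-from (no a≁b) (yes b~c) (no c≁d) =
      placed-covers (c121 (part b) (offset b)) e tt
        (<-other-part ab a≁b) (refl , refl) (sym b~c , <-same-part bc b~c) (≡-<-≡ b~c (<-other-part cd c≁d) refl)
    covers-from (no a≁b) (no b≁c) (yes c~d) =
      placed-covers (c112 (part b) (part c) (offset c)) e (<-other-part bc b≁c)
        (<-other-part ab a≁b) refl (refl , refl) (sym c~d , <-same-part cd c~d)
    covers-from (yes a~b) (yes b~c) (no c≁d) =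
      placed-covers (c31 (part a) (offset a) (offset b)) e (<-same-part ab a~b)
        (refl , refl) (sym a~b , refl) (sym (trans a~b b~c) , <-same-part bc b~c)
        (≡-<-≡ (trans a~b b~c) (<-other-part cd c≁d) refl)
    covers-from (no a≁b) (yes b~c) (yes c~d) =
      placed-covers (c13 (part b) (offset b) (offset c)) e (<-same-part bc b~c)
        (<-other-part ab a≁b) (refl , refl) (sym b~c , refl) (sym (trans b~c c~d) , <-same-part cd c~d)
    covers-from (yes a~b) (yes b~c) (yes c~d) =
      placed-covers (c4 (part a) (offset a) (offset b) (offset c)) e (<-same-part ab a~b , <-same-part bc b~c)
        (refl , refl) (sym a~b , refl) (sym (trans a~b b~c) , refl) (sym (trans a~b (trans b~c c~d)) , <-same-part cd c~d)
    covers-from (yes a~b) (no b≁c) (yes c~d) = valid , λ v → ∈E4-split⁺ (piece γ v) e first second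
      where
      ef : Edge m × Edge m
      ef = offsetEdge a b ab a~b , offsetEdge c d cd c~d
      β : Fin kg
      β = blockOf ef
      γ : Code
      γ = c22 (part a) (part c) β
      first : OnePerClass (classOf γ zero) (classOf γ (suc zero)) a b
      first = sides⁺ {part a} (proj₁ (𝓑 β)) refl (sym a~b) (proj₁ (∈blockOf ef))
      second : OnePerClass (classOf γ (suc (suc zero))) (classOf γ (suc (suc (suc zero)))) c d
      second = sides⁺ {part c} (proj₂ (𝓑 β)) refl (sym c~d) (proj₂ (∈blockOf ef))
      valid : Valid γ
      valid = ≡-<-≡ a~b (<-other-part bc b≁c) refl , λ
        { zero → proj₁ (onePerClass⇒nonempty first) ; (suc zero) → proj₂ (onePerClass⇒nonempty first)
        ; (suc (suc zero)) → proj₁ (onePerClass⇒nonempty second)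
        ; (suc (suc (suc zero))) → proj₂ (onePerClass⇒nonempty second) }

    code-1111 : ∀ x y z → ¬ part a ≡ part b → ¬ part b ≡ part c → ¬ part c ≡ part d →
      codeFrom a b c d ab cd x y z ≡ c1111 (part b) (part c)
    code-1111 x y z n₁ n₂ n₃ rewrite dec-no x n₁ | dec-no y n₂ | dec-no z n₃ = refl

    code-211 : ∀ x y z → part a ≡ part b → ¬ part b ≡ part c → ¬ part c ≡ part d →
      codeFrom a b c d ab cd x y z ≡ c211 (part a) (offset a) (part c)
    code-211 x y z q₁ n₂ n₃ rewrite dec-yes-irr x ≡-irrelevant q₁ | dec-no y n₂ | dec-no z n₃ = refl

    code-121 : ∀ x y z → ¬ part a ≡ part b → part b ≡ part c → ¬ part c ≡ part d →
      codeFrom a b c d ab cd x y z ≡ c121 (part b) (offset b)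
    code-121 x y z n₁ q₂ n₃ rewrite dec-no x n₁ | dec-yes-irr y ≡-irrelevant q₂ | dec-no z n₃ = refl

    code-112 : ∀ x y z → ¬ part a ≡ part b → ¬ part b ≡ part c → part c ≡ part d →
      codeFrom a b c d ab cd x y z ≡ c112 (part b) (part c) (offset c)
    code-112 x y z n₁ n₂ q₃ rewrite dec-no x n₁ | dec-no y n₂ | dec-yes-irr z ≡-irrelevant q₃ = refl

    code-31 : ∀ x y z → part a ≡ part b → part b ≡ part c → ¬ part c ≡ part d →
      codeFrom a b c d ab cd x y z ≡ c31 (part a) (offset a) (offset b)
    code-31 x y z q₁ q₂ n₃
      rewrite dec-yes-irr x ≡-irrelevant q₁ | dec-yes-irr y ≡-irrelevant q₂ | dec-no z n₃ = refl

    code-13 : ∀ x y z → ¬ part a ≡ part b → part b ≡ part c → part c ≡ part d →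
      codeFrom a b c d ab cd x y z ≡ c13 (part b) (offset b) (offset c)
    code-13 x y z n₁ q₂ q₃
      rewrite dec-no x n₁ | dec-yes-irr y ≡-irrelevant q₂ | dec-yes-irr z ≡-irrelevant q₃ = refl

    code-22 : ∀ x y z (q₁ : part a ≡ part b) → ¬ part b ≡ part c → (q₃ : part c ≡ part d) →
      codeFrom a b c d ab cd x y z ≡ c22 (part a) (part c) (blockOf (offsetEdge a b ab q₁ , offsetEdge c d cd q₃))
    code-22 x y z q₁ n₂ q₃
      rewrite dec-yes-irr x ≡-irrelevant q₁ | dec-no y n₂ | dec-yes-irr z ≡-irrelevant q₃ = refl

    code-4 : ∀ x y z → part a ≡ part b → part b ≡ part c → part c ≡ part d →
      codeFrom a b c d ab cd x y z ≡ c4 (part a) (offset a) (offset b) (offset c)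
    code-4 x y z q₁ q₂ q₃
      rewrite dec-yes-irr x ≡-irrelevant q₁ | dec-yes-irr y ≡-irrelevant q₂ | dec-yes-irr z ≡-irrelevant q₃ = refl

    chain-sound : ∀ γ → IsChainCode γ → Ordered γ →
      region γ zero ∋ a → region γ (suc zero) ∋ b → region γ (suc (suc zero)) ∋ c →
      region γ (suc (suc (suc zero))) ∋ d → ∀ x y z → γ ≡ codeFrom a b c d ab cd x y z
    chain-sound (c1111 _ _) _ j<k a< refl refl <d x y z =
      sym (code-1111 x y z (<⇒≢ a<) (<⇒≢ j<k) (<⇒≢ <d))
    chain-sound (c211 _ _ _) _ i<k (refl , refl) (b~a , _) refl <d x y z =
      sym (code-211 x y z (sym b~a) (<⇒≢ (≡-<-≡ b~a i<k refl)) (<⇒≢ <d))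
    chain-sound (c121 _ _) _ _ a< (refl , refl) (c~b , _) <d x y z =
      sym (code-121 x y z (<⇒≢ a<) (sym c~b) (<⇒≢ (≡-<-≡ c~b <d refl)))
    chain-sound (c112 _ _ _) _ j<i a< refl (refl , refl) (d~c , _) x y z =
      sym (code-112 x y z (<⇒≢ a<) (<⇒≢ j<i) (sym d~c))
    chain-sound (c31 _ _ _) _ _ (refl , refl) (b~a , refl) (c~a , _) <d x y z =
      sym (code-31 x y z (sym b~a) (trans b~a (sym c~a)) (<⇒≢ (≡-<-≡ c~a <d refl)))
    chain-sound (c13 _ _ _) _ _ a< (refl , refl) (c~b , refl) (d~b , _) x y z =
      sym (code-13 x y z (<⇒≢ a<) (sym c~b) (trans c~b (sym d~b)))
    chain-sound (c4 _ _ _ _) _ _ (refl , refl) (b~a , refl) (c~a , refl) (d~a , _) x y z =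
      sym (code-4 x y z (sym b~a) (trans b~a (sym c~a)) (trans c~a (sym d~a)))

    -- Soundness for split pieces: the block is determined by the offsets of the edge.
    split-sound : ∀ i j β → i < j →
      OnePerClass (classOf (c22 i j β) zero) (classOf (c22 i j β) (suc zero)) a b →
      OnePerClass (classOf (c22 i j β) (suc (suc zero))) (classOf (c22 i j β) (suc (suc (suc zero)))) c d →
      ∀ x y z → c22 i j β ≡ codeFrom a b c d ab cd x y z
    split-sound i j β i<j first second x y z with sides⁻ (proj₁ (𝓑 β)) first | sides⁻ (proj₂ (𝓑 β)) second
    ... | refl , b~a , across₁ | refl , d~c , across₂ = sym (trans
      (code-22 x y z (sym b~a) (<⇒≢ (≡-<-≡ b~a i<j refl)) (sym d~c))
      (cong (c22 (part a) (part c)) (blockOf-unique _ β (across₁ , across₂))))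

  complete : ∀ e → Covers (code e) e
  complete ((a , b , c , d) , ab , bc , cd) =
    covers-from a b c d ab bc cd (part a ≟ part b) (part b ≟ part c) (part c ≟ part d)

  class-piece : ∀ γ v k → class (piece γ v) k ≡ classOf γ k
  class-piece γ v zero = refl
  class-piece γ v (suc zero) = refl
  class-piece γ v (suc (suc zero)) = refl
  class-piece γ v (suc (suc (suc zero))) = refl

  -- A chain piece containing e places its vertices in its regions in order, which determines its code.
  chain-piece-sound : ∀ e γ v → IsChainCode γ → e ∈E4 piece γ v → γ ≡ code e
  chain-piece-sound e@((a , b , c , d) , ab , bc , cd) γ v@(ord , _) isChain e∈ =
    chain-sound a b c d ab bc cd γ isChain ord
      (inRegion zero) (inRegion (suc zero)) (inRegion (suc (suc zero))) (inRegion (suc (suc (suc zero)))) _ _ _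
    where
    r₀≺r₁ : region γ zero ≺ region γ (suc zero)
    r₀≺r₁ = proj₁ (chain γ ord isChain)
    r₁≺r₂ : region γ (suc zero) ≺ region γ (suc (suc zero))
    r₁≺r₂ = proj₁ (proj₂ (chain γ ord isChain))
    r₂≺r₃ : region γ (suc (suc zero)) ≺ region γ (suc (suc (suc zero)))
    r₂≺r₃ = proj₂ (proj₂ (chain γ ord isChain))
    inRegion : ∀ k → region γ k ∋ vertex e k
    inRegion k = ∈classOf⁻ γ k (subst (vertex e k ∈_) (class-piece γ v k)
      (∈E4-chain⁻ (piece γ v) e e∈ (≺⇒Precedes r₀≺r₁) (≺⇒Precedes r₁≺r₂) (≺⇒Precedes r₂≺r₃) k))

  -- A split piece containing e splits {a, b} and {c, d} across its sides, which determines its code.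
  split-piece-sound : ∀ e i j β v → e ∈E4 piece (c22 i j β) v → c22 i j β ≡ code e
  split-piece-sound e@((a , b , c , d) , ab , bc , cd) i j β v@(i<j , _) e∈ =
    split-sound a b c d ab bc cd i j β i<j (proj₁ split) (proj₂ split) _ _ _
    where
    B₁ B₂ : CompleteBipartite m
    B₁ = proj₁ (𝓑 β)
    B₂ = proj₂ (𝓑 β)
    across : ∀ P Q → Precedes (vertices (offsetsIn i P)) (vertices (offsetsIn j Q))
    across P Q = ≺⇒Precedes {offsetsIn i P} {offsetsIn j Q} (offsetsIn≺offsetsIn P Q i<j)
    split : OnePerClass (classOf (c22 i j β) zero) (classOf (c22 i j β) (suc zero)) a b ×
            OnePerClass (classOf (c22 i j β) (suc (suc zero))) (classOf (c22 i j β) (suc (suc (suc zero)))) c d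
    split = ∈E4-split⁻ (piece (c22 i j β) v) e e∈
      (across (X B₁) (X B₂)) (across (X B₁) (Y B₂)) (across (Y B₁) (X B₂)) (across (Y B₁) (Y B₂))

  sound : ∀ e γ v → e ∈E4 piece γ v → γ ≡ code e
  sound e (c22 i j β) v = split-piece-sound e i j β v
  sound e γ@(c1111 _ _) v = chain-piece-sound e γ v tt
  sound e γ@(c211 _ _ _) v = chain-piece-sound e γ v tt
  sound e γ@(c121 _ _) v = chain-piece-sound e γ v tt
  sound e γ@(c112 _ _ _) v = chain-piece-sound e γ v tt
  sound e γ@(c31 _ _ _) v = chain-piece-sound e γ v tt
  sound e γ@(c13 _ _ _) v = chain-piece-sound e γ v tt
  sound e γ@(c4 _ _ _ _) v = chain-piece-sound e γ v tt

  -- Listing all codes that can be valid: eight families, one per run pattern, each a grid of parts,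
  -- offsets and (for c22) blocks.  The family of a code is recorded by its shape.
  pattern s1111 = zero
  pattern s211 = suc s1111
  pattern s121 = suc s211
  pattern s112 = suc s121
  pattern s31 = suc s112
  pattern s13 = suc s31
  pattern s22 = suc s13
  pattern s4 = suc s22

  shape : Code → Fin 8
  shape (c1111 _ _) = s1111
  shape (c211 _ _ _) = s211
  shape (c121 _ _) = s121
  shape (c112 _ _ _) = s112
  shape (c31 _ _ _) = s31
  shape (c13 _ _ _) = s13
  shape (c22 _ _ _) = s22
  shape (c4 _ _ _ _) = s4

  private
    range : ℕ → List ℕ
    range = downFrom

    _⊗_ : ∀ {A B : Set} → List A → List B → List (A × B)
    _⊗_ = cartesianProduct
    infixr 5 _⊗_

  family : Fin 8 → List Code
  family s1111 = map (λ (j , k) → c1111 j k) (range t ⊗ range t)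
  family s211 = map (λ (i , x , k) → c211 i x k) (range t ⊗ range m ⊗ range t)
  family s121 = map (λ (i , x) → c121 i x) (range t ⊗ range m)
  family s112 = map (λ (j , i , x) → c112 j i x) (range t ⊗ range t ⊗ range m)
  family s31 = map (λ (i , x , y) → c31 i x y) (range t ⊗ range m ⊗ range m)
  family s13 = map (λ (i , x , y) → c13 i x y) (range t ⊗ range m ⊗ range m)
  family s22 = map (λ ((i , j) , β) → c22 i j β) (increasingPairs t ⊗ allFin kg)
  family s4 = map (λ (i , x , y , z) → c4 i x y z) (range t ⊗ range m ⊗ range m ⊗ range m)

  family-unique : ∀ s → Unique (family s)
  family-unique s1111 = map⁺ (λ { refl → refl }) (cartesianProduct⁺ (downFrom⁺ t) (downFrom⁺ t))
  family-unique s211 = map⁺ (λ { refl → refl })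
    (cartesianProduct⁺ (downFrom⁺ t) (cartesianProduct⁺ (downFrom⁺ m) (downFrom⁺ t)))
  family-unique s121 = map⁺ (λ { refl → refl }) (cartesianProduct⁺ (downFrom⁺ t) (downFrom⁺ m))
  family-unique s112 = map⁺ (λ { refl → refl })
    (cartesianProduct⁺ (downFrom⁺ t) (cartesianProduct⁺ (downFrom⁺ t) (downFrom⁺ m)))
  family-unique s31 = map⁺ (λ { refl → refl })
    (cartesianProduct⁺ (downFrom⁺ t) (cartesianProduct⁺ (downFrom⁺ m) (downFrom⁺ m)))
  family-unique s13 = map⁺ (λ { refl → refl })
    (cartesianProduct⁺ (downFrom⁺ t) (cartesianProduct⁺ (downFrom⁺ m) (downFrom⁺ m)))
  family-unique s22 = map⁺ (λ { refl → refl }) (cartesianProduct⁺ (increasingPairs-unique t) (allFin⁺ kg))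
  family-unique s4 = map⁺ (λ { refl → refl })
    (cartesianProduct⁺ (downFrom⁺ t) (cartesianProduct⁺ (downFrom⁺ m) (cartesianProduct⁺ (downFrom⁺ m) (downFrom⁺ m))))

  family-keyed : ∀ s {γ} → γ ∈ₗ family s → shape γ ≡ s
  family-keyed s1111 = map-keyed shape _ (λ _ → refl)
  family-keyed s211 = map-keyed shape _ (λ _ → refl)
  family-keyed s121 = map-keyed shape _ (λ _ → refl)
  family-keyed s112 = map-keyed shape _ (λ _ → refl)
  family-keyed s31 = map-keyed shape _ (λ _ → refl)
  family-keyed s13 = map-keyed shape _ (λ _ → refl)
  family-keyed s22 = map-keyed shape _ (λ _ → refl)
  family-keyed s4 = map-keyed shape _ (λ _ → refl)

  codes : List Code
  codes = concatMap family (allFin 8)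

  codes-unique : Unique codes
  codes-unique = concatMap⁺ shape (allFin⁺ 8) family-unique family-keyed

  wholePart<t : ∀ {j} → Nonempty (vertices (wholePart j)) → j < t
  wholePart<t {j} (v , v∈) = subst (_< t) (∈⟦⟧⁻ (wholePart j ∋?_) v∈) (part<t v)

  point-bounds : ∀ {i x} → Nonempty (vertices (point i x)) → i < t × x < m
  point-bounds {i} {x} (v , v∈) with ∈⟦⟧⁻ (point i x ∋?_) v∈
  ... | refl , refl = part<t v , offset<m v

  offsetsIn<t : ∀ {i X} → Nonempty (vertices (offsetsIn i X)) → i < t
  offsetsIn<t {i} {X} (v , v∈) = subst (_< t) (proj₁ (∈⟦⟧⁻ (offsetsIn i X ∋?_) v∈)) (part<t v)

  valid-in-family : ∀ γ → Valid γ → γ ∈ₗ family (shape γ)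
  valid-in-family (c1111 j k) (_ , ne) = ∈-map⁺ _ (∈-cartesianProduct⁺
    (∈-downFrom⁺ (wholePart<t (ne (suc zero)))) (∈-downFrom⁺ (wholePart<t (ne (suc (suc zero))))))
  valid-in-family (c211 i x k) (_ , ne) = ∈-map⁺ _ (∈-cartesianProduct⁺
    (∈-downFrom⁺ (proj₁ (point-bounds (ne zero)))) (∈-cartesianProduct⁺
    (∈-downFrom⁺ (proj₂ (point-bounds (ne zero)))) (∈-downFrom⁺ (wholePart<t (ne (suc (suc zero)))))))
  valid-in-family (c121 i x) (_ , ne) = ∈-map⁺ _ (∈-cartesianProduct⁺
    (∈-downFrom⁺ (proj₁ (point-bounds (ne (suc zero))))) (∈-downFrom⁺ (proj₂ (point-bounds (ne (suc zero))))))
  valid-in-family (c112 j i x) (_ , ne) = ∈-map⁺ _ (∈-cartesianProduct⁺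
    (∈-downFrom⁺ (wholePart<t (ne (suc zero)))) (∈-cartesianProduct⁺
    (∈-downFrom⁺ (proj₁ (point-bounds (ne (suc (suc zero)))))) (∈-downFrom⁺ (proj₂ (point-bounds (ne (suc (suc zero))))))))
  valid-in-family (c31 i x y) (_ , ne) = ∈-map⁺ _ (∈-cartesianProduct⁺
    (∈-downFrom⁺ (proj₁ (point-bounds (ne zero)))) (∈-cartesianProduct⁺
    (∈-downFrom⁺ (proj₂ (point-bounds (ne zero)))) (∈-downFrom⁺ (proj₂ (point-bounds (ne (suc zero)))))))
  valid-in-family (c13 i x y) (_ , ne) = ∈-map⁺ _ (∈-cartesianProduct⁺
    (∈-downFrom⁺ (proj₁ (point-bounds (ne (suc zero))))) (∈-cartesianProduct⁺
    (∈-downFrom⁺ (proj₂ (point-bounds (ne (suc zero))))) (∈-downFrom⁺ (proj₂ (point-bounds (ne (suc (suc zero))))))))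
  valid-in-family (c22 i j β) (i<j , ne) = ∈-map⁺ _ (∈-cartesianProduct⁺
    (∈-increasingPairs i<j (offsetsIn<t (ne (suc (suc zero))))) (∈-allFin β))
  valid-in-family (c4 i x y z) (_ , ne) = ∈-map⁺ _ (∈-cartesianProduct⁺
    (∈-downFrom⁺ (proj₁ (point-bounds (ne zero)))) (∈-cartesianProduct⁺
    (∈-downFrom⁺ (proj₂ (point-bounds (ne zero)))) (∈-cartesianProduct⁺
    (∈-downFrom⁺ (proj₂ (point-bounds (ne (suc zero))))) (∈-downFrom⁺ (proj₂ (point-bounds (ne (suc (suc zero)))))))))

  valid⇒listed : ∀ γ → Valid γ → γ ∈ₗ codes
  valid⇒listed γ v = ∈-concatMap⁺ family (lose (∈-allFin (shape γ)) (valid-in-family γ v))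

  private
    length-range² : ∀ a b → length (range a ⊗ range b) ≡ a * b
    length-range² a b =
      trans (length-cartesianProduct (range a) (range b)) (cong₂ _*_ (length-downFrom a) (length-downFrom b))
    length-range³ : ∀ a b c → length (range a ⊗ range b ⊗ range c) ≡ a * (b * c)
    length-range³ a b c =
      trans (length-cartesianProduct (range a) (range b ⊗ range c)) (cong₂ _*_ (length-downFrom a) (length-range² b c))
    length-range⁴ : ∀ a b c d → length (range a ⊗ range b ⊗ range c ⊗ range d) ≡ a * (b * (c * d))
    length-range⁴ a b c d =
      trans (length-cartesianProduct (range a) (range b ⊗ range c ⊗ range d)) (cong₂ _*_ (length-downFrom a) (length-range³ b c d))

  pairs : ℕ
  pairs = length (increasingPairs t)

  family-size : Fin 8 → ℕ
  family-size s1111 = t * t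
  family-size s211 = t * (m * t)
  family-size s121 = t * m
  family-size s112 = t * (t * m)
  family-size s31 = t * (m * m)
  family-size s13 = t * (m * m)
  family-size s22 = pairs * kg
  family-size s4 = t * (m * (m * m))

  family-length : ∀ s → length (family s) ≡ family-size s
  family-length s1111 = trans (length-map _ (range t ⊗ range t)) (length-range² t t)
  family-length s211 = trans (length-map _ (range t ⊗ range m ⊗ range t)) (length-range³ t m t)
  family-length s121 = trans (length-map _ (range t ⊗ range m)) (length-range² t m)
  family-length s112 = trans (length-map _ (range t ⊗ range t ⊗ range m)) (length-range³ t t m)
  family-length s31 = trans (length-map _ (range t ⊗ range m ⊗ range m)) (length-range³ t m m)
  family-length s13 = trans (length-map _ (range t ⊗ range m ⊗ range m)) (length-range³ t m m)
  family-length s22 = trans (length-map _ (increasingPairs t ⊗ allFin kg))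
    (trans (length-cartesianProduct (increasingPairs t) (allFin kg)) (cong (pairs *_) (length-tabulate (λ β → β))))
  family-length s4 = trans (length-map _ (range t ⊗ range m ⊗ range m ⊗ range m)) (length-range⁴ t m m m)

  length-codes : length codes ≡ chainCodes t m + pairs * kg
  length-codes = begin
      length codes                                          ≡⟨ length-concatMap family (allFin 8) ⟩
      sum (map (λ s → length (family s)) (allFin 8))       ≡⟨ cong sum (map-cong family-length (allFin 8)) ⟩
      sum (map family-size (allFin 8))                      ≡⟨ regroup t m (pairs * kg) ⟩
      chainCodes t m + pairs * kg                                   ∎
    where
    open Relation.Binary.PropositionalEquality.≡-Reasoning
    regroup : ∀ t m p → t * t + (t * (m * t) + (t * m + (t * (t * m) + (t * (m * m) + (t * (m * m) +
              (p + (t * (m * (m * m)) + 0))))))) ≡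
              t * t + t * (m * t) + t * m + t * (t * m) + t * (m * m) + t * (m * m) + t * (m * (m * m)) + p
    regroup = solve-∀

  partition : Σ ℕ λ k → HyperPartition n k × k ≤ chainCodes t m + pairs * kg
  partition = length (filter valid? codes) ,
    PartitionFromCodes.partition Valid valid? piece code complete sound codes codes-unique
      (λ e → valid⇒listed (code e) (proj₁ (complete e))) ,
    ≤-trans (length-filter valid? codes) (≤-reflexive length-codes)

module Estimates where

  open import Data.Nat using (zero; suc; _+_; _*_; _^_; _≤_; _<_)
  open import Data.Nat.Properties
    using (≤-reflexive; ≤-trans; +-monoˡ-≤; +-monoʳ-≤; *-monoˡ-≤; *-monoʳ-≤; *-mono-≤; ^-monoˡ-≤;
           n≤1+n; m≤m+n; <⇒≤; module ≤-Reasoning)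
  open import Data.Nat.Tactic.RingSolver using (solve-∀)
  open import Data.Nat.Solver using (module +-*-Solver)
  open import Relation.Binary.PropositionalEquality using (_≡_; refl; cong)
  open +-*-Solver using (solve; _:+_; _:*_; _:^_; con; _:=_)
  open CodeCount

  power-gap : ∀ s k → suc s ^ suc k ≤ s ^ suc k + suc k * suc s ^ k
  power-gap s zero = ≤-reflexive (base s)
    where base : ∀ s → suc s * 1 ≡ s * 1 + 1 * 1
          base = solve-∀
  power-gap s (suc k) = begin
      suc s ^ suc k + s * suc s ^ suc k                          ≤⟨ +-monoʳ-≤ (suc s ^ suc k) (*-monoʳ-≤ s (power-gap s k)) ⟩
      suc s ^ suc k + s * (s ^ suc k + suc k * suc s ^ k)        ≡⟨ regroup (suc s ^ suc k) s (s ^ suc k) (suc k) (suc s ^ k) ⟩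
      s * s ^ suc k + (suc s ^ suc k + suc k * (s * suc s ^ k))  ≤⟨ +-monoʳ-≤ (s * s ^ suc k) (+-monoʳ-≤ (suc s ^ suc k) (*-monoʳ-≤ (suc k) (*-monoˡ-≤ (suc s ^ k) (n≤1+n s)))) ⟩
      s * s ^ suc k + (suc s ^ suc k + suc k * (suc s * suc s ^ k)) ∎
    where
    open ≤-Reasoning
    regroup : ∀ a s b c d → a + s * (b + c * d) ≡ s * b + (a + c * (s * d))
    regroup = solve-∀

  dominance : ∀ K s → 0 < s → 1984 * K ≤ s → K * (suc s ^ 6 + 56 * suc s ^ 5) ≤ suc K * s ^ 6
  dominance K s@(suc r) _ 1984K≤s = begin
      K * (suc s ^ 6 + 56 * suc s ^ 5)               ≤⟨ *-monoʳ-≤ K (+-monoˡ-≤ _ (power-gap s 5)) ⟩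
      K * (s ^ 6 + 6 * suc s ^ 5 + 56 * suc s ^ 5)   ≤⟨ *-monoʳ-≤ K (+-mono-≤′ {s ^ 6} (*-monoʳ-≤ 6 m⁵≤) (*-monoʳ-≤ 56 m⁵≤)) ⟩
      K * (s ^ 6 + 6 * (2 * s) ^ 5 + 56 * (2 * s) ^ 5) ≡⟨ expand K s ⟩
      K * s ^ 6 + 1984 * K * s ^ 5                   ≤⟨ +-monoʳ-≤ _ (*-monoˡ-≤ (s ^ 5) 1984K≤s) ⟩
      K * s ^ 6 + s * s ^ 5                          ≡⟨ collect K s ⟩
      suc K * s ^ 6                                  ∎
    where
    open ≤-Reasoning
    m≤2s : suc s ≤ 2 * s
    m≤2s = ≤-trans (m≤m+n (suc s) r) (≤-reflexive (double r))
      where double : ∀ r → suc (suc r) + r ≡ 2 * suc r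
            double = solve-∀
    m⁵≤ : suc s ^ 5 ≤ (2 * s) ^ 5
    m⁵≤ = ^-monoˡ-≤ 5 m≤2s
    +-mono-≤′ : ∀ {a b c d e} → b ≤ c → d ≤ e → a + b + d ≤ a + c + e
    +-mono-≤′ {a} b≤c d≤e = Data.Nat.Properties.+-mono-≤ (+-monoʳ-≤ a b≤c) d≤e
    expand : ∀ K s → K * (s ^ 6 + 6 * (2 * s) ^ 5 + 56 * (2 * s) ^ 5) ≡ K * s ^ 6 + 1984 * K * s ^ 5
    expand = solve 2 (λ K s → K :* (s :^ 6 :+ con 6 :* (con 2 :* s) :^ 5 :+ con 56 :* (con 2 :* s) :^ 5)
                            := K :* s :^ 6 :+ con 1984 :* K :* s :^ 5) refl
    collect : ∀ K s → K * s ^ 6 + s * s ^ 5 ≡ suc K * s ^ 6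
    collect = solve 2 (λ K s → K :* s :^ 6 :+ s :* s :^ 5 := (con 1 :+ K) :* s :^ 6) refl

  -- The chain codes number at most 7 m⁵ when t = m²:  7m⁵ − (3m⁵ + 3m⁴ + m³) = m³ (m − 1)(4m + 1).
  chainCodes-bound : ∀ s → chainCodes (suc s * suc s) (suc s) ≤ 7 * suc s ^ 5
  chainCodes-bound s = ≤-trans (m≤m+n _ (suc s ^ 3 * (s * (4 * s + 5)))) (≤-reflexive (difference s))
    where difference : ∀ s → chainCodes (suc s * suc s) (suc s) + suc s ^ 3 * (s * (4 * s + 5)) ≡ 7 * suc s ^ 5
          difference = solve 1 (λ s → let m = con 1 :+ s ; t = m :* m in
            t :* t :+ t :* (m :* t) :+ t :* m :+ t :* (t :* m) :+ t :* (m :* m) :+ t :* (m :* m) :+ t :* (m :* (m :* m))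
            :+ m :^ 3 :* (s :* (con 4 :* s :+ con 5)) := con 7 :* m :^ 5) refl

  estimate : ∀ K s n P → let m = suc s in
    0 < s → 1984 * K ≤ s → s ^ 3 < n → 2 * P ≤ (m * m) * (m * m) →
    2 * K * (4 * chainCodes (m * m) m + P * (m * m)) ≤ suc K * (n * n)
  estimate K s n P 0<s 1984K≤s s³<n 2P≤t² = begin
      2 * K * (4 * chainCodes (m * m) m + P * (m * m))   ≡⟨ split K (chainCodes (m * m) m) P m ⟩
      K * (8 * chainCodes (m * m) m) + K * (2 * P * (m * m))
        ≤⟨ Data.Nat.Properties.+-mono-≤ (*-monoʳ-≤ K (*-monoʳ-≤ 8 (chainCodes-bound s)))
                                          (*-monoʳ-≤ K (*-monoˡ-≤ (m * m) 2P≤t²)) ⟩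
      K * (8 * (7 * m ^ 5)) + K * ((m * m) * (m * m) * (m * m)) ≡⟨ powers K m ⟩
      K * (m ^ 6 + 56 * m ^ 5)                           ≤⟨ dominance K s 0<s 1984K≤s ⟩
      suc K * s ^ 6                                      ≡⟨ cong (suc K *_) (square-cube s) ⟩
      suc K * (s ^ 3 * s ^ 3)                            ≤⟨ *-monoʳ-≤ (suc K) (*-mono-≤ (<⇒≤ s³<n) (<⇒≤ s³<n)) ⟩
      suc K * (n * n)                                    ∎
    where
    open ≤-Reasoning
    m : ℕ
    m = suc s
    split : ∀ K C P m → 2 * K * (4 * C + P * (m * m)) ≡ K * (8 * C) + K * (2 * P * (m * m))
    split = solve-∀
    powers : ∀ K m → K * (8 * (7 * m ^ 5)) + K * ((m * m) * (m * m) * (m * m)) ≡ K * (m ^ 6 + 56 * m ^ 5)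
    powers = solve 2 (λ K m → K :* (con 8 :* (con 7 :* m :^ 5)) :+ K :* ((m :* m) :* (m :* m) :* (m :* m))
                           := K :* (m :^ 6 :+ con 56 :* m :^ 5)) refl
    square-cube : ∀ s → s ^ 6 ≡ s ^ 3 * s ^ 3
    square-cube = solve 1 (λ s → s :^ 6 := s :^ 3 :* s :^ 3) refl

module NaturalsInRationals where

  open import Data.Nat as ℕ using (suc)
  import Data.Nat.Properties as ℕ
  open import Data.Nat.Coprimality using (1-coprimeTo) renaming (sym to coprime-sym)
  open import Data.Integer as ℤ using (+_; +[1+_]; -[1+_])
  import Data.Integer.Properties as ℤ
  open import Data.Rational using (ℚ; mkℚ; _+_; _*_; _≤_; _<_; 0ℚ; 1ℚ; *≤*; *<*)
  import Data.Rational as ℚ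
  open import Data.Rational.Properties using (normalize-coprime; /-cong; toℚᵘ-cancel-≤; toℚᵘ-homo-*)
  import Data.Rational.Unnormalised as ℚᵘ
  import Data.Rational.Unnormalised.Properties as ℚᵘ
  open import Relation.Binary.PropositionalEquality using (_≡_; refl; sym; trans; cong₂; subst; subst₂)
  open import Data.Product using (Σ; _,_)

  ℕ→ℚ≡mkℚ : ∀ n → ℕ→ℚ n ≡ mkℚ (+ n) 0 (coprime-sym (1-coprimeTo n))
  ℕ→ℚ≡mkℚ n = normalize-coprime (coprime-sym (1-coprimeTo n))

  ℕ→ℚ-+ : ∀ a b → ℕ→ℚ (a ℕ.+ b) ≡ ℕ→ℚ a + ℕ→ℚ b
  ℕ→ℚ-+ a b rewrite ℕ→ℚ≡mkℚ a | ℕ→ℚ≡mkℚ b = trans (ℕ→ℚ≡mkℚ (a ℕ.+ b))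
    (sym (trans (/-cong {p₂ = + (a ℕ.+ b)} {q₂ = 1} numerators refl) (ℕ→ℚ≡mkℚ (a ℕ.+ b))))
    where numerators : + a ℤ.* + 1 ℤ.+ + b ℤ.* + 1 ≡ + (a ℕ.+ b)
          numerators = trans (cong₂ ℤ._+_ (ℤ.*-identityʳ (+ a)) (ℤ.*-identityʳ (+ b))) (sym (ℤ.pos-+ a b))

  ℕ→ℚ-* : ∀ a b → ℕ→ℚ (a ℕ.* b) ≡ ℕ→ℚ a * ℕ→ℚ b
  ℕ→ℚ-* a b rewrite ℕ→ℚ≡mkℚ a | ℕ→ℚ≡mkℚ b = trans (ℕ→ℚ≡mkℚ (a ℕ.* b))
    (sym (trans (/-cong {p₂ = + (a ℕ.* b)} {q₂ = 1} (sym (ℤ.pos-* a b)) refl) (ℕ→ℚ≡mkℚ (a ℕ.* b))))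

  ℕ→ℚ-mono-≤ : ∀ {a b} → a ℕ.≤ b → ℕ→ℚ a ≤ ℕ→ℚ b
  ℕ→ℚ-mono-≤ {a} {b} a≤b rewrite ℕ→ℚ≡mkℚ a | ℕ→ℚ≡mkℚ b =
    *≤* (subst₂ ℤ._≤_ (sym (ℤ.*-identityʳ (+ a))) (sym (ℤ.*-identityʳ (+ b))) (ℤ.+≤+ a≤b))

  ℕ→ℚ-mono-< : ∀ {a b} → a ℕ.< b → ℕ→ℚ a < ℕ→ℚ b
  ℕ→ℚ-mono-< {a} {b} a<b rewrite ℕ→ℚ≡mkℚ a | ℕ→ℚ≡mkℚ b =
    *<* (subst₂ ℤ._<_ (sym (ℤ.*-identityʳ (+ a))) (sym (ℤ.*-identityʳ (+ b))) (ℤ.+<+ a<b))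

  -- Archimedean property: a positive ε = (p+1)/q satisfies 1 ≤ ε · q.
  archimedean : ∀ ε → 0ℚ < ε → Σ ℕ λ K → 1ℚ ≤ ε * ℕ→ℚ (suc K)
  archimedean ε@(mkℚ +[1+ p ] q-1 _) _ = q-1 , toℚᵘ-cancel-≤ (ℚᵘ.≤-respʳ-≃ (ℚᵘ.≃-sym (toℚᵘ-homo-* ε (ℕ→ℚ q))) unnormalised)
    where
    q : ℕ
    q = suc q-1
    unnormalised : ℚᵘ._≤_ (ℚ.toℚᵘ 1ℚ) (ℚᵘ._*_ (ℚ.toℚᵘ ε) (ℚ.toℚᵘ (ℕ→ℚ q)))
    unnormalised rewrite ℕ→ℚ≡mkℚ q =
      ℚᵘ.*≤* (subst₂ ℤ._≤_ (sym (ℤ.*-identityˡ _)) (sym (ℤ.*-identityʳ _))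
        (subst (+ (q ℕ.* 1) ℤ.≤_) (sym (ℤ.pos-* (suc p) q)) (ℤ.+≤+ q≤[p+1]q)))
      where
      q≤[p+1]q : q ℕ.* 1 ℕ.≤ suc p ℕ.* q
      q≤[p+1]q = subst (ℕ._≤ suc p ℕ.* q) (sym (ℕ.*-identityʳ q)) (ℕ.m≤m+n q (p ℕ.* q))
  archimedean (mkℚ (+ 0) _ _) (*<* (ℤ.+<+ ()))
  archimedean (mkℚ -[1+ _ ] _ _) (*<* ())

module Rescaling where

  open import Data.Nat as ℕ using (suc; z≤n)
  import Data.Integer as ℤ
  open import Data.Rational using (ℚ; _+_; _*_; _/_; _≤_; 1ℚ; NonNegative; Positive; nonNegative; positive)
  open import Data.Rational.Properties
    using (+-mono-≤; +-monoˡ-≤; *-monoˡ-≤-nonNeg; *-monoʳ-≤-nonNeg; *-cancelˡ-≤-pos; *-identityʳ; *-assoc; module ≤-Reasoning)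
  open import Data.Rational.Solver using (module +-*-Solver)
  open import Relation.Binary.PropositionalEquality using (_≡_; refl; sym; trans; cong; cong₂)
  open +-*-Solver using (solve; _:+_; _:*_; con; _:=_)
  open NaturalsInRationals

  ½ : ℚ
  ½ = ℤ.+ 1 / 2

  ℕ→ℚ-nonNeg : ∀ a → NonNegative (ℕ→ℚ a)
  ℕ→ℚ-nonNeg a = nonNegative (ℕ→ℚ-mono-≤ {0} {a} z≤n)

  absorb : ∀ (α : ℚ) (k R P g m : ℕ) → k ℕ.≤ R ℕ.+ P ℕ.* g →
    1ℚ ≤ α * ℕ→ℚ 4 → ℕ→ℚ g ≤ α * (ℕ→ℚ m * ℕ→ℚ m) →
    ℕ→ℚ k ≤ α * ℕ→ℚ (4 ℕ.* R ℕ.+ P ℕ.* (m ℕ.* m))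
  absorb α k R P g m k≤ 1≤4α g≤αm² = begin
      ℕ→ℚ k                                       ≤⟨ ℕ→ℚ-mono-≤ k≤ ⟩
      ℕ→ℚ (R ℕ.+ P ℕ.* g)                         ≡⟨ trans (ℕ→ℚ-+ R (P ℕ.* g)) (cong (ℕ→ℚ R +_) (ℕ→ℚ-* P g)) ⟩
      ℕ→ℚ R + ℕ→ℚ P * ℕ→ℚ g                     ≡⟨ cong (_+ ℕ→ℚ P * ℕ→ℚ g) (sym (*-identityʳ (ℕ→ℚ R))) ⟩
      ℕ→ℚ R * 1ℚ + ℕ→ℚ P * ℕ→ℚ g
        ≤⟨ +-mono-≤ (*-monoˡ-≤-nonNeg (ℕ→ℚ R) {{ℕ→ℚ-nonNeg R}} 1≤4α)
                    (*-monoˡ-≤-nonNeg (ℕ→ℚ P) {{ℕ→ℚ-nonNeg P}} g≤αm²) ⟩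
      ℕ→ℚ R * (α * ℕ→ℚ 4) + ℕ→ℚ P * (α * (ℕ→ℚ m * ℕ→ℚ m))
        ≡⟨ factor (ℕ→ℚ R) α (ℕ→ℚ 4) (ℕ→ℚ P) (ℕ→ℚ m) ⟩
      α * (ℕ→ℚ 4 * ℕ→ℚ R + ℕ→ℚ P * (ℕ→ℚ m * ℕ→ℚ m))
        ≡⟨ cong (α *_) (sym (trans (ℕ→ℚ-+ (4 ℕ.* R) _)
             (cong₂ _+_ (ℕ→ℚ-* 4 R) (trans (ℕ→ℚ-* P (m ℕ.* m)) (cong (ℕ→ℚ P *_) (ℕ→ℚ-* m m)))))) ⟩
      α * ℕ→ℚ (4 ℕ.* R ℕ.+ P ℕ.* (m ℕ.* m))       ∎
    where
    open ≤-Reasoning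
    factor : ∀ r a c p x → r * (a * c) + p * (a * (x * x)) ≡ a * (c * r + p * (x * x))
    factor = solve 5 (λ r a c p x → r :* (a :* c) :+ p :* (a :* (x :* x)) := a :* (c :* r :+ p :* (x :* x))) refl

  slack : ∀ (ε : ℚ) (K W N : ℕ) → 1ℚ ≤ ε * ℕ→ℚ (suc K) →
    2 ℕ.* suc K ℕ.* W ℕ.≤ suc (suc K) ℕ.* N → ℕ→ℚ W ≤ (1ℚ + ε) * (ℕ→ℚ N * ½)
  slack ε K W N 1≤εk 2kW≤ = begin
      w                           ≡⟨ sym (halve w) ⟩
      (two * w) * ½               ≤⟨ *-monoʳ-≤-nonNeg ½ (*-cancelˡ-≤-pos k k[2w]≤k[[1+ε]x]) ⟩
      ((1ℚ + ε) * x) * ½          ≡⟨ *-assoc (1ℚ + ε) x ½ ⟩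
      (1ℚ + ε) * (x * ½)          ∎
    where
    open ≤-Reasoning
    k w x two : ℚ
    k = ℕ→ℚ (suc K)
    w = ℕ→ℚ W
    x = ℕ→ℚ N
    two = ℕ→ℚ 2
    instance
      k-positive : Positive k
      k-positive = positive (ℕ→ℚ-mono-< {0} {suc K} (ℕ.s≤s z≤n))
    halve : ∀ w → (two * w) * ½ ≡ w
    halve = solve 1 (λ w → (con two :* w) :* con ½ := w) refl
    k[2w]≤k[[1+ε]x] : k * (two * w) ≤ k * ((1ℚ + ε) * x)
    k[2w]≤k[[1+ε]x] = begin
      k * (two * w)               ≡⟨ trans (swap k two w) (sym (trans (ℕ→ℚ-* (2 ℕ.* suc K) W) (cong (_* w) (ℕ→ℚ-* 2 (suc K))))) ⟩
      ℕ→ℚ (2 ℕ.* suc K ℕ.* W)     ≤⟨ ℕ→ℚ-mono-≤ 2kW≤ ⟩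
      ℕ→ℚ (suc (suc K) ℕ.* N)     ≡⟨ trans (ℕ→ℚ-* (suc (suc K)) N) (cong (_* x) (ℕ→ℚ-+ 1 (suc K))) ⟩
      (1ℚ + k) * x                ≤⟨ *-monoʳ-≤-nonNeg x {{ℕ→ℚ-nonNeg N}} (+-monoˡ-≤ k 1≤εk) ⟩
      (ε * k + k) * x             ≡⟨ regroup ε k x ⟩
      k * ((1ℚ + ε) * x)          ∎
      where swap : ∀ k c w → k * (c * w) ≡ (c * k) * w
            swap = solve 3 (λ k c w → k :* (c :* w) := (c :* k) :* w) refl
            regroup : ∀ e k x → (e * k + k) * x ≡ k * ((1ℚ + e) * x)
            regroup = solve 3 (λ e k x → (e :* k :+ k) :* x := k :* ((con 1ℚ :+ e) :* x)) refl

  combine : ∀ (α ε : ℚ) {{_ : NonNegative α}} (k W n : ℕ) → ℕ→ℚ k ≤ α * ℕ→ℚ W →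
    ℕ→ℚ W ≤ (1ℚ + ε) * (ℕ→ℚ (n ℕ.* n) * ½) → ℕ→ℚ k ≤ α * (1ℚ + ε) * ((ℕ→ℚ n * ℕ→ℚ n) * ½)
  combine α ε k W n k≤αW W≤ = begin
      ℕ→ℚ k                                     ≤⟨ k≤αW ⟩
      α * ℕ→ℚ W                                 ≤⟨ *-monoˡ-≤-nonNeg α W≤ ⟩
      α * ((1ℚ + ε) * (ℕ→ℚ (n ℕ.* n) * ½))       ≡⟨ sym (*-assoc α (1ℚ + ε) _) ⟩
      α * (1ℚ + ε) * (ℕ→ℚ (n ℕ.* n) * ½)         ≡⟨ cong (λ y → α * (1ℚ + ε) * (y * ½)) (ℕ→ℚ-* n n) ⟩
      α * (1ℚ + ε) * ((ℕ→ℚ n * ℕ→ℚ n) * ½)       ∎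
    where open ≤-Reasoning

module CubeRoot where

  open import Data.Nat using (zero; suc; _^_; _≤_; _<_; _≤?_; s≤s; z≤n)
  open import Data.Nat.Properties using (≤-trans; m<n⇒m<1+n; ≰⇒>; ≮⇒≥; <⇒≱; ^-monoˡ-<; n<1+n)
  open import Data.Product using (_,_)
  open import Relation.Nullary using (yes; no)

  cube-root : ∀ n → 0 < n → Σ ℕ λ s → s ^ 3 < n × n ≤ suc s ^ 3
  cube-root (suc zero) _ = 0 , s≤s z≤n , s≤s z≤n
  cube-root (suc (suc n)) _ with cube-root (suc n) (s≤s z≤n)
  ... | s , s³<n , n≤[s+1]³ with suc (suc n) ≤? suc s ^ 3
  ... | yes fits = s , m<n⇒m<1+n s³<n , fits
  ... | no exceeds = suc s , ≰⇒> exceeds , ≤-trans (s≤s n≤[s+1]³) (^-monoˡ-< 3 (n<1+n (suc s)))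

  cube-reflects-≤ : ∀ {a b} → a ^ 3 ≤ b ^ 3 → a ≤ b
  cube-reflects-≤ a³≤b³ = ≮⇒≥ (λ b<a → <⇒≱ (^-monoˡ-< 3 b<a) a³≤b³)

module Assembly where

  open import Data.Nat using (suc; _+_; _*_; _^_; _≤_; _<_; s≤s; z≤n)
  open import Data.Nat.Properties using (≤-trans; ≤-reflexive)
  open import Data.Nat.Solver using (module +-*-Solver)
  open import Data.Fin using (Fin; zero; suc)
  open import Data.Product using (_,_; proj₁; proj₂)
  open import Data.Rational as ℚ using (ℚ; 0ℚ; 1ℚ)
  open import Data.Rational.Properties using (<⇒≤) renaming (≤-trans to ≤ℚ-trans)
  open import Relation.Binary.PropositionalEquality using (_≡_; refl)
  open +-*-Solver using (solve; _:*_; _:^_; _:=_; con)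
  open NaturalsInRationals
  open Rescaling
  open import Data.List using (length)
  open Enumeration using (increasingPairs; 2*length-increasingPairs)

  GBound : ℚ → Set
  GBound α = (n : ℕ) → g≤ n (α ℚ.* (ℕ→ℚ n ℚ.* ℕ→ℚ n))

  -- g(2) ≥ 1, as E(K₂) × E(K₂) is nonempty; hence the hypothesis g(2) ≤ 4α forces 1 ≤ 4α.
  one≤4α : ∀ α → GBound α → 1ℚ ℚ.≤ α ℚ.* ℕ→ℚ 4
  one≤4α α g-bound with g-bound 2
  ... | k , (_ , covered) , k≤4α =
    ≤ℚ-trans (ℕ→ℚ-mono-≤ (has-block k (proj₁ (proj₁ (covered (e , e)))))) k≤4α
    where
    e : Edge 2
    e = (zero , suc zero) , s≤s z≤n
    has-block : ∀ k → Fin k → 1 ≤ k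
    has-block (suc _) _ = s≤s z≤n

  between-cubes : ∀ α ε → 0ℚ ℚ.< α → GBound α → (K : ℕ) → 1ℚ ℚ.≤ ε ℚ.* ℕ→ℚ (suc K) →
    ∀ s n → 1984 * suc K ≤ s → s ^ 3 < n → n ≤ suc s ^ 3 →
    f₄≤ n (α ℚ.* (1ℚ ℚ.+ ε) ℚ.* ((ℕ→ℚ n ℚ.* ℕ→ℚ n) ℚ.* ½))
  between-cubes α ε α>0 g-bound K 1≤εK s n 1984K≤s s³<n n≤m³ = from-blocks (g-bound m)
    where
    m t : ℕ
    m = suc s
    t = m * m
    n≤tm : n ≤ t * m
    n≤tm = ≤-trans n≤m³ (≤-reflexive (cube m))
      where cube : ∀ m → m ^ 3 ≡ (m * m) * m
            cube = solve 1 (λ m → m :^ 3 := (m :* m) :* m) refl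
    pairs W : ℕ
    pairs = length (increasingPairs t)
    W = 4 * CodeCount.chainCodes t m + pairs * (m * m)
    from-blocks : g≤ m (α ℚ.* (ℕ→ℚ m ℚ.* ℕ→ℚ m)) → f₄≤ n (α ℚ.* (1ℚ ℚ.+ ε) ℚ.* ((ℕ→ℚ n ℚ.* ℕ→ℚ n) ℚ.* ½))
    from-blocks (kg , blocks , kg≤αm²) =
      let (k , partition , k≤) = Construction.partition m t n n≤tm kg blocks in
      k , partition ,
      combine α ε {{ℚ.nonNegative (<⇒≤ α>0)}} k W n
        (absorb α k (CodeCount.chainCodes t m) pairs kg m k≤ (one≤4α α g-bound) kg≤αm²)
        (slack ε K W (n * n) 1≤εK
          (Estimates.estimate (suc K) s n pairs (≤-trans (s≤s z≤n) 1984K≤s) 1984K≤s s³<n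
            (2*length-increasingPairs t)))

open import Data.Nat using (ℕ; _≥_)
open import Data.Product using (Σ; _×_)
open import Data.Rational using (ℚ; 0ℚ; 1ℚ; _<_; _+_; _*_; _/_)
open import Data.Integer using (+_)

proposition1 : (α : ℚ) → 0ℚ < α →
    ((n : ℕ) → g≤ n (α * (ℕ→ℚ n * ℕ→ℚ n))) →
    (ε : ℚ) → 0ℚ < ε →
    Σ ℕ λ N → (n : ℕ) → n ≥ N →
    f₄≤ n (α * (1ℚ + ε) * ((ℕ→ℚ n * ℕ→ℚ n) * ((+ 1) / 2)))
proposition1 α α>0 g-bound ε ε>0 = threshold , large-n
  where
  open import Data.Nat as ℕ using (suc; _^_; s≤s; z≤n)
  open import Data.Nat.Properties using (≤-trans; ≤-pred)
  open import Data.Product using (_,_; proj₁; proj₂)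
  open NaturalsInRationals using (archimedean)
  open CubeRoot
  K threshold : ℕ
  K = proj₁ (archimedean ε ε>0)
  threshold = suc (1984 ℕ.* suc K) ^ 3
  large-n : (n : ℕ) → n ≥ threshold → f₄≤ n (α * (1ℚ + ε) * ((ℕ→ℚ n * ℕ→ℚ n) * ((+ 1) / 2)))
  large-n n n≥ with cube-root n (≤-trans (s≤s z≤n) n≥)
  ... | s , s³<n , n≤[s+1]³ =
    Assembly.between-cubes α ε α>0 g-bound K (proj₂ (archimedean ε ε>0)) s n
      (≤-pred (cube-reflects-≤ (≤-trans n≥ n≤[s+1]³))) s³<n n≤[s+1]³
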